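{- Let $G$ be a graph, $a\ge 3$ an integer, and suppose $G$ contains a clique $Q^i$ on $i$ vertices with $i \ge a$ and $i \not\equiv 0 \pmod{a-1}$. Then the clique inequality $\sum_{e\in E(Q^i)} x_e \le ex(i,a,2)$ is facet-defining for $T(G,a,2)$. In particular, for every $n \ge i$ and every $i$-vertex clique $Q^i$ of $K_n$, it is facet-defining for $T(n,a,2)$.
   Context: For a graph $G$, $T(G,a,2)\subseteq\mathbb{R}^{E(G)}$ is the convex hull of the characteristic vectors of all edge sets $F \subseteq E(G)$ containing no clique on $a$ vertices; $T(n,a,2) = T(K_n,a,2)$. $ex(i,a,2)$ is the maximum number of edges of a graph on $i$ vertices with no clique on $a$ vertices. -}

module Defs where

open import Data.Bool using (Bool; true; false; if_then_else_; _∧_; not)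
open import Data.Nat using (ℕ; zero; suc; _<ᵇ_)
import Data.Nat as ℕ
open import Data.Fin using (Fin; toℕ; _≟_)
open import Data.Integer using (+_)
open import Data.Rational using (ℚ; 0ℚ; 1ℚ; _+_; _*_; _≤_; _/_)
open import Data.Product using (Σ; _×_)
open import Function using (_∘_)
open import Function.Definitions using (Injective)
open import Relation.Binary.PropositionalEquality using (_≡_; _≢_)
open import Relation.Nullary using (¬_; ⌊_⌋)

sumℚ : (n : ℕ) → (Fin n → ℚ) → ℚ
sumℚ zero    f = 0ℚ
sumℚ (suc n) f = f Fin.zero + sumℚ n (f ∘ Fin.suc)
  where import Data.Fin as Fin

sumℕ : (n : ℕ) → (Fin n → ℕ) → ℕ
sumℕ zero    f = 0
sumℕ (suc n) f = f Fin.zero ℕ.+ sumℕ n (f ∘ Fin.suc)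
  where import Data.Fin as Fin

fromℕℚ : ℕ → ℚ
fromℕℚ m = + m / 1

EdgeRel : ℕ → Set
EdgeRel n = Fin n → Fin n → Bool

record Graph (n : ℕ) : Set where
  field
    adj    : EdgeRel n
    adj-sym    : ∀ u v → adj u v ≡ adj v u
    adj-irrefl : ∀ u → adj u u ≡ false
open Graph public

complete : (n : ℕ) → Graph n
complete n = record { adj = λ u v → not ⌊ u ≟ v ⌋ ; adj-sym = symK ; adj-irrefl = irrK }
  where
  open import Relation.Binary.PropositionalEquality using (refl; sym)
  open import Relation.Nullary using (yes; no)
  symK : ∀ u v → not ⌊ u ≟ v ⌋ ≡ not ⌊ v ≟ u ⌋
  symK u v with u ≟ v | v ≟ u
  ... | yes _ | yes _ = refl
  ... | no _  | no _  = refl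
  ... | yes p | no q  = Data.Empty.⊥-elim (q (sym p))
    where import Data.Empty
  ... | no p  | yes q = Data.Empty.⊥-elim (p (sym q))
    where import Data.Empty
  irrK : ∀ u → not ⌊ u ≟ u ⌋ ≡ false
  irrK u with u ≟ u
  ... | yes _ = refl
  ... | no p  = Data.Empty.⊥-elim (p refl)
    where import Data.Empty

HasClique : ∀ {n} → ℕ → EdgeRel n → Set
HasClique {n} a F =
  Σ (Fin a → Fin n) λ f → Injective _≡_ _≡_ f × (∀ j k → j ≢ k → F (f j) (f k) ≡ true)

EdgeSubset : ∀ {n} → Graph n → EdgeRel n → Set
EdgeSubset G F = (∀ u v → F u v ≡ F v u) × (∀ u v → F u v ≡ true → adj G u v ≡ true)

-- The vertex set of T(G,a,2): edge sets F ⊆ E(G) containing no a-clique.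
InT : ∀ {n} → Graph n → ℕ → EdgeRel n → Set
InT G a F = EdgeSubset G F × ¬ HasClique a F

-- Vectors in ℚ^{E(G)}, embedded as (symmetric) functions on ordered pairs.
QVec : ℕ → Set
QVec n = Fin n → Fin n → ℚ

χ : ∀ {n} → EdgeRel n → QVec n
χ F u v = if F u v then 1ℚ else 0ℚ

AffInd : ∀ {n m} → (Fin m → QVec n) → Set
AffInd {n} {m} p =
  (λ' : Fin m → ℚ) → sumℚ m λ' ≡ 0ℚ →
  (∀ u v → sumℚ m (λ j → λ' j * p j u v) ≡ 0ℚ) → ∀ j → λ' j ≡ 0ℚ

HasAffInd : ∀ {n} → (EdgeRel n → Set) → ℕ → Set
HasAffInd {n} S m =
  Σ (Fin m → EdgeRel n) λ Fs → (∀ j → S (Fs j)) × AffInd (χ ∘ Fs)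

-- m is the maximum number of affinely independent points of conv{χ F : S F},
-- i.e. its dimension is m - 1.
MaxAffInd : ∀ {n} → (EdgeRel n → Set) → ℕ → Set
MaxAffInd S m = HasAffInd S m × ¬ HasAffInd S (suc m)

-- L x ≤ b is facet-defining for P = conv{χ F : S F}: it is valid, and the face
-- conv{χ F : S F, L (χ F) = b} has dimension dim P - 1.
FacetDefining : ∀ {n} → (EdgeRel n → Set) → (QVec n → ℚ) → ℚ → Set
FacetDefining S L b =
  (∀ F → S F → L (χ F) ≤ b) ×
  Σ ℕ λ m → MaxAffInd S (suc m) × MaxAffInd (λ F → S F × L (χ F) ≡ b) m

cliqueLHS : ∀ {n i} → (Fin i → Fin n) → QVec n → ℚ
cliqueLHS {n} {i} q x =
  sumℚ i λ j → sumℚ i λ k → if toℕ j <ᵇ toℕ k then x (q j) (q k) else 0ℚ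

edgeCount : ∀ {i} → Graph i → ℕ
edgeCount {i} H =
  sumℕ i λ j → sumℕ i λ k → if (toℕ j <ᵇ toℕ k) ∧ adj H j k then 1 else 0

IsEx : ℕ → ℕ → ℕ → Set
IsEx i a m =
  (Σ (Graph i) λ H → ¬ HasClique a (adj H) × edgeCount H ≡ m) ×
  (∀ (H : Graph i) → ¬ HasClique a (adj H) → edgeCount H ℕ.≤ m)

{-# OPTIONS --safe #-}
module Submission where

-- T(G,a,2) is full-dimensional (the empty set and the single edges), and the clique inequality is valid
-- because F ∩ E(Q) is an a-clique-free graph on i vertices. For the facet we exhibit |E(G)| linearly
-- independent tight points: lifts of extremal graphs on Q, and lifts with one extra edge of G leaving Q.
-- A functional vanishing on all of them vanishes on the edges leaving Q, and on E(Q) it is a weight f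
-- whose total over the edges of each of these extremal graphs is 0. By Zykov symmetrization,
-- non-adjacency is an equivalence relation in an extremal graph, so when (a-1) ∤ i an extremal graph
-- is not regular and has u ≁ v, u ~ w with deg w = deg u + 1. Relabelling and cloning turn it into four
-- extremal graphs whose comparison gives f(x,y) = f(x,z) for distinct x, y, z; so f is constant, hence 0.

open import Defs
open import Data.Nat using (ℕ; _≤_; _∸_)
open import Data.Nat.Divisibility using (_∣_)
open import Data.Fin using (Fin)
open import Data.Bool using (true)
open import Data.Product using (_×_)
open import Function.Definitions using (Injective)
open import Relation.Binary.PropositionalEquality using (_≡_; _≢_)
open import Relation.Nullary using (¬_)

open import Algebra.Bundles using (module Ring)
import Algebra.Properties.CommutativeMonoid.Sum as CommutativeMonoidSum
import Algebra.Properties.Semiring.Sum as SemiringSum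
open import Data.Bool using (Bool; false; if_then_else_; _∧_; _∨_; not)
import Data.Bool as Bool
import Data.Bool.Properties as Boolₚ
open import Data.Empty using (⊥; ⊥-elim)
open import Data.Fin using (zero; suc; toℕ; _≟_)
import Data.Fin as Fin
open import Data.Fin.Permutation using (Permutation′; transpose; _∘ₚ_; _⟨$⟩ʳ_; _⟨$⟩ˡ_; inverseˡ)
import Data.Fin.Properties as Finₚ
import Data.Integer as ℤ
import Data.Integer.Properties as ℤₚ
open import Data.List using (List; []; _∷_; allFin; filter; cartesianProduct; lookup; length)
open import Data.List.Membership.Propositional using (_∈_)
open import Data.List.Membership.Propositional.Properties using (∈-allFin; ∈-filter⁺; ∈-filter⁻; ∈-cartesianProduct⁺; ∈-lookup)
import Data.List.Relation.Unary.All as All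
open import Data.List.Relation.Unary.AllPairs using (_∷_)
import Data.List.Relation.Unary.Any as Any
open import Data.List.Relation.Unary.Any using (here; there)
open import Data.List.Relation.Unary.Any.Properties using (lookup-index)
open import Data.List.Relation.Unary.Unique.Propositional using (Unique)
open import Data.List.Relation.Unary.Unique.Propositional.Properties using (filter⁺; cartesianProduct⁺; allFin⁺)
open import Data.Nat using (zero; suc; _<_; _<ᵇ_; z≤n; s≤s)
import Data.Nat as ℕ
open import Data.Nat.Divisibility using (divides)
import Data.Nat.Properties as ℕₚ
open import Data.Product using (Σ-syntax; ∃-syntax; _,_; proj₁; proj₂)
open import Data.Product.Function.NonDependent.Propositional using (_×-↔_)
open import Data.Rational using (ℚ; 0ℚ; 1ℚ; _+_; _*_; -_; 1/_)
import Data.Rational as ℚ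
import Data.Rational.Properties as ℚₚ
open import Data.Rational.Solver using (module +-*-Solver)
import Data.Rational.Unnormalised as ℚᵘ
import Data.Rational.Unnormalised.Properties as ℚᵘₚ
open import Data.Sum using (_⊎_; inj₁; inj₂)
open import Data.Sum.Function.Propositional using (_⊎-↔_)
open import Data.Vec.Functional using (updateAt)
open import Data.Vec.Functional.Properties using (updateAt-updates; updateAt-minimal)
open import Function using (_∘_; const)
open import Function.Bundles using (module Equivalence; _↔_; module Inverse)
open import Function.Construct.Composition using (_↔-∘_)
open import Function.Construct.Identity using (↔-id)
open import Relation.Binary using (tri<; tri≈; tri>)
import Relation.Binary.Reasoning.Setoid as SetoidReasoning
open import Relation.Binary.PropositionalEquality using (refl; sym; trans; cong; cong₂; subst; subst₂; module ≡-Reasoning)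
open import Relation.Nullary using (Dec; yes; no; does; ⌊_⌋; ¬?)
open import Relation.Nullary.Decidable using (_×-dec_; dec-true; dec-false)

open +-*-Solver using (solve; _:=_; _:+_; _:*_; :-_; con)

-- Finite sums

module ℚSum = SemiringSum (Ring.semiring ℚₚ.+-*-ring)
module ℕSum = CommutativeMonoidSum ℕₚ.+-0-commutativeMonoid

sumℚ≡sum : ∀ n (f : Fin n → ℚ) → sumℚ n f ≡ ℚSum.sum f
sumℚ≡sum zero    f = refl
sumℚ≡sum (suc n) f = cong (f zero +_) (sumℚ≡sum n (f ∘ suc))

sumℕ≡sum : ∀ n (f : Fin n → ℕ) → sumℕ n f ≡ ℕSum.sum f
sumℕ≡sum zero    f = refl
sumℕ≡sum (suc n) f = cong (f zero ℕ.+_) (sumℕ≡sum n (f ∘ suc))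

sumℚ-cong : ∀ n {f g : Fin n → ℚ} → (∀ j → f j ≡ g j) → sumℚ n f ≡ sumℚ n g
sumℚ-cong zero    f≗g = refl
sumℚ-cong (suc n) f≗g = cong₂ _+_ (f≗g zero) (sumℚ-cong n (f≗g ∘ suc))

sumℚ-zero : ∀ n {f : Fin n → ℚ} → (∀ j → f j ≡ 0ℚ) → sumℚ n f ≡ 0ℚ
sumℚ-zero zero    f≗0 = refl
sumℚ-zero (suc n) f≗0 = cong₂ _+_ (f≗0 zero) (sumℚ-zero n (f≗0 ∘ suc))

sumℚ-single : ∀ n (j₀ : Fin n) {f : Fin n → ℚ} → (∀ j → j ≢ j₀ → f j ≡ 0ℚ) → sumℚ n f ≡ f j₀
sumℚ-single (suc n) zero     {f} f≗0 =
  trans (cong (f zero +_) (sumℚ-zero n (λ j → f≗0 (suc j) λ ()))) (ℚₚ.+-identityʳ (f zero))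
sumℚ-single (suc n) (suc j₀) {f} f≗0 =
  trans (cong₂ _+_ (f≗0 zero λ ()) (sumℚ-single n j₀ (λ j j≢j₀ → f≗0 (suc j) (j≢j₀ ∘ Finₚ.suc-injective))))
        (ℚₚ.+-identityˡ _)

sumℚ-distrib-+ : ∀ n (f g : Fin n → ℚ) → sumℚ n (λ j → f j + g j) ≡ sumℚ n f + sumℚ n g
sumℚ-distrib-+ n f g = begin
  sumℚ n (λ j → f j + g j)   ≡⟨ sumℚ≡sum n _ ⟩
  ℚSum.sum (λ j → f j + g j) ≡⟨ ℚSum.∑-distrib-+ f g ⟩
  ℚSum.sum f + ℚSum.sum g    ≡⟨ sym (cong₂ _+_ (sumℚ≡sum n f) (sumℚ≡sum n g)) ⟩
  sumℚ n f + sumℚ n g        ∎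
  where open ≡-Reasoning

*-distribˡ-sumℚ : ∀ n c (f : Fin n → ℚ) → c * sumℚ n f ≡ sumℚ n (λ j → c * f j)
*-distribˡ-sumℚ n c f = begin
  c * sumℚ n f               ≡⟨ cong (c *_) (sumℚ≡sum n f) ⟩
  c * ℚSum.sum f             ≡⟨ ℚSum.*-distribˡ-sum c f ⟩
  ℚSum.sum (λ j → c * f j)   ≡⟨ sym (sumℚ≡sum n _) ⟩
  sumℚ n (λ j → c * f j)     ∎
  where open ≡-Reasoning

*-distribʳ-sumℚ : ∀ n c (f : Fin n → ℚ) → sumℚ n f * c ≡ sumℚ n (λ j → f j * c)
*-distribʳ-sumℚ n c f = begin
  sumℚ n f * c               ≡⟨ cong (_* c) (sumℚ≡sum n f) ⟩
  ℚSum.sum f * c             ≡⟨ ℚSum.*-distribʳ-sum c f ⟩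
  ℚSum.sum (λ j → f j * c)   ≡⟨ sym (sumℚ≡sum n _) ⟩
  sumℚ n (λ j → f j * c)     ∎
  where open ≡-Reasoning

neg-distrib-sumℚ : ∀ n (f : Fin n → ℚ) → - sumℚ n f ≡ sumℚ n (λ j → - f j)
neg-distrib-sumℚ zero    f = refl
neg-distrib-sumℚ (suc n) f =
  trans (ℚₚ.neg-distrib-+ (f zero) (sumℚ n (f ∘ suc))) (cong (- f zero +_) (neg-distrib-sumℚ n (f ∘ suc)))

sumℚ-sub : ∀ n (f g : Fin n → ℚ) → sumℚ n f + - sumℚ n g ≡ sumℚ n (λ j → f j + - g j)
sumℚ-sub n f g = trans (cong (sumℚ n f +_) (neg-distrib-sumℚ n g)) (sym (sumℚ-distrib-+ n f (λ j → - g j)))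

sumℚ-comm : ∀ n m (f : Fin n → Fin m → ℚ) →
            sumℚ n (λ j → sumℚ m (f j)) ≡ sumℚ m (λ k → sumℚ n (λ j → f j k))
sumℚ-comm n m f = begin
  sumℚ n (λ j → sumℚ m (f j))                     ≡⟨ sumℚ-cong n (λ j → sumℚ≡sum m (f j)) ⟩
  sumℚ n (λ j → ℚSum.sum (f j))                   ≡⟨ sumℚ≡sum n _ ⟩
  ℚSum.sum (λ j → ℚSum.sum (f j))                 ≡⟨ ℚSum.∑-comm f ⟩
  ℚSum.sum (λ k → ℚSum.sum (λ j → f j k))         ≡⟨ sym (sumℚ≡sum m _) ⟩
  sumℚ m (λ k → ℚSum.sum (λ j → f j k))           ≡⟨ sym (sumℚ-cong m (λ k → sumℚ≡sum n (λ j → f j k))) ⟩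
  sumℚ m (λ k → sumℚ n (λ j → f j k))             ∎
  where open ≡-Reasoning

sumℕ-cong : ∀ n {f g : Fin n → ℕ} → (∀ j → f j ≡ g j) → sumℕ n f ≡ sumℕ n g
sumℕ-cong zero    f≗g = refl
sumℕ-cong (suc n) f≗g = cong₂ ℕ._+_ (f≗g zero) (sumℕ-cong n (f≗g ∘ suc))

sumℕ-zero : ∀ n {f : Fin n → ℕ} → (∀ j → f j ≡ 0) → sumℕ n f ≡ 0
sumℕ-zero zero    f≗0 = refl
sumℕ-zero (suc n) f≗0 = cong₂ ℕ._+_ (f≗0 zero) (sumℕ-zero n (f≗0 ∘ suc))

sumℕ-single : ∀ n (j₀ : Fin n) {f : Fin n → ℕ} → (∀ j → j ≢ j₀ → f j ≡ 0) → sumℕ n f ≡ f j₀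
sumℕ-single (suc n) zero     {f} f≗0 =
  trans (cong (f zero ℕ.+_) (sumℕ-zero n (λ j → f≗0 (suc j) λ ()))) (ℕₚ.+-identityʳ (f zero))
sumℕ-single (suc n) (suc j₀) {f} f≗0 =
  cong₂ ℕ._+_ (f≗0 zero λ ()) (sumℕ-single n j₀ (λ j j≢j₀ → f≗0 (suc j) (j≢j₀ ∘ Finₚ.suc-injective)))

sumℕ-const : ∀ n c → sumℕ n (λ _ → c) ≡ n ℕ.* c
sumℕ-const zero    c = refl
sumℕ-const (suc n) c = cong (c ℕ.+_) (sumℕ-const n c)

sumℕ-count : ∀ n → sumℕ n (λ _ → 1) ≡ n
sumℕ-count n = trans (sumℕ-const n 1) (ℕₚ.*-identityʳ n)

sumℕ-mono-≤ : ∀ n {f g : Fin n → ℕ} → (∀ j → f j ≤ g j) → sumℕ n f ≤ sumℕ n g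
sumℕ-mono-≤ zero    f≤g = z≤n
sumℕ-mono-≤ (suc n) f≤g = ℕₚ.+-mono-≤ (f≤g zero) (sumℕ-mono-≤ n (f≤g ∘ suc))

sumℕ-distrib-+ : ∀ n (f g : Fin n → ℕ) → sumℕ n (λ j → f j ℕ.+ g j) ≡ sumℕ n f ℕ.+ sumℕ n g
sumℕ-distrib-+ n f g = begin
  sumℕ n (λ j → f j ℕ.+ g j)    ≡⟨ sumℕ≡sum n _ ⟩
  ℕSum.sum (λ j → f j ℕ.+ g j)  ≡⟨ ℕSum.∑-distrib-+ f g ⟩
  ℕSum.sum f ℕ.+ ℕSum.sum g     ≡⟨ sym (cong₂ ℕ._+_ (sumℕ≡sum n f) (sumℕ≡sum n g)) ⟩
  sumℕ n f ℕ.+ sumℕ n g         ∎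
  where open ≡-Reasoning

sumℕ-comm : ∀ n m (f : Fin n → Fin m → ℕ) →
            sumℕ n (λ j → sumℕ m (f j)) ≡ sumℕ m (λ k → sumℕ n (λ j → f j k))
sumℕ-comm n m f = begin
  sumℕ n (λ j → sumℕ m (f j))                     ≡⟨ sumℕ-cong n (λ j → sumℕ≡sum m (f j)) ⟩
  sumℕ n (λ j → ℕSum.sum (f j))                   ≡⟨ sumℕ≡sum n _ ⟩
  ℕSum.sum (λ j → ℕSum.sum (f j))                 ≡⟨ ℕSum.∑-comm f ⟩
  ℕSum.sum (λ k → ℕSum.sum (λ j → f j k))         ≡⟨ sym (sumℕ≡sum m _) ⟩
  sumℕ m (λ k → ℕSum.sum (λ j → f j k))           ≡⟨ sym (sumℕ-cong m (λ k → sumℕ≡sum n (λ j → f j k))) ⟩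
  sumℕ m (λ k → sumℕ n (λ j → f j k))             ∎
  where open ≡-Reasoning

sumℕ-permute : ∀ n (f : Fin n → ℕ) (π : Permutation′ n) → sumℕ n (λ j → f (π ⟨$⟩ʳ j)) ≡ sumℕ n f
sumℕ-permute n f π = begin
  sumℕ n (λ j → f (π ⟨$⟩ʳ j))   ≡⟨ sumℕ≡sum n _ ⟩
  ℕSum.sum (λ j → f (π ⟨$⟩ʳ j)) ≡⟨ sym (ℕSum.sum-permute f π) ⟩
  ℕSum.sum f                    ≡⟨ sym (sumℕ≡sum n f) ⟩
  sumℕ n f                      ∎
  where open ≡-Reasoning

term≤sumℕ : ∀ n (f : Fin n → ℕ) j → f j ≤ sumℕ n f
term≤sumℕ (suc n) f zero    = ℕₚ.m≤m+n (f zero) (sumℕ n (f ∘ suc))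
term≤sumℕ (suc n) f (suc j) = ℕₚ.≤-trans (term≤sumℕ n (f ∘ suc) j) (ℕₚ.m≤n+m (sumℕ n (f ∘ suc)) (f zero))

fromℕℚ≃ : ∀ m → ℚ.toℚᵘ (fromℕℚ m) ℚᵘ.≃ ℚᵘ.mkℚᵘ (ℤ.+ m) 0
fromℕℚ≃ m = ℚₚ.toℚᵘ-fromℚᵘ (ℚᵘ.mkℚᵘ (ℤ.+ m) 0)

fromℕℚ-+ : ∀ a b → fromℕℚ (a ℕ.+ b) ≡ fromℕℚ a + fromℕℚ b
fromℕℚ-+ a b = ℚₚ.toℚᵘ-injective (begin
  ℚ.toℚᵘ (fromℕℚ (a ℕ.+ b))                     ≈⟨ fromℕℚ≃ (a ℕ.+ b) ⟩
  ℚᵘ.mkℚᵘ (ℤ.+ (a ℕ.+ b)) 0                     ≈⟨ ℚᵘ.*≡* denominators-one ⟩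
  ℚᵘ.mkℚᵘ (ℤ.+ a) 0 ℚᵘ.+ ℚᵘ.mkℚᵘ (ℤ.+ b) 0      ≈⟨ ℚᵘₚ.≃-sym (ℚᵘₚ.+-cong (fromℕℚ≃ a) (fromℕℚ≃ b)) ⟩
  ℚ.toℚᵘ (fromℕℚ a) ℚᵘ.+ ℚ.toℚᵘ (fromℕℚ b)      ≈⟨ ℚᵘₚ.≃-sym (ℚₚ.toℚᵘ-homo-+ (fromℕℚ a) (fromℕℚ b)) ⟩
  ℚ.toℚᵘ (fromℕℚ a + fromℕℚ b)                  ∎)
  where
  open SetoidReasoning ℚᵘₚ.≃-setoid
  denominators-one : (ℤ.+ a ℤ.+ ℤ.+ b) ℤ.* ℤ.+ 1 ≡ (ℤ.+ a ℤ.* ℤ.+ 1 ℤ.+ ℤ.+ b ℤ.* ℤ.+ 1) ℤ.* ℤ.+ 1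
  denominators-one rewrite ℤₚ.*-identityʳ (ℤ.+ a) | ℤₚ.*-identityʳ (ℤ.+ b) = refl

fromℕℚ-mono-≤ : ∀ {a b} → a ≤ b → fromℕℚ a ℚ.≤ fromℕℚ b
fromℕℚ-mono-≤ {a} {b} a≤b = ℚₚ.toℚᵘ-cancel-≤
  (ℚᵘₚ.≤-respʳ-≃ (ℚᵘₚ.≃-sym (fromℕℚ≃ b)) (ℚᵘₚ.≤-respˡ-≃ (ℚᵘₚ.≃-sym (fromℕℚ≃ a))
    (ℚᵘ.*≤* (subst₂ ℤ._≤_ (sym (ℤₚ.*-identityʳ (ℤ.+ a))) (sym (ℤₚ.*-identityʳ (ℤ.+ b))) (ℤ.+≤+ a≤b)))))

fromℕℚ-suc≢0 : ∀ a → fromℕℚ (suc a) ≢ 0ℚ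
fromℕℚ-suc≢0 a eq = ℚₚ.<-irrefl (sym eq) (ℚₚ.<-≤-trans (ℚₚ.positive⁻¹ 1ℚ) 1≤1+a)
  where
  1≤1+a : 1ℚ ℚ.≤ fromℕℚ (suc a)
  1≤1+a = subst (1ℚ ℚ.≤_) (sym (fromℕℚ-+ 1 a))
            (subst (ℚ._≤ 1ℚ + fromℕℚ a) (ℚₚ.+-identityʳ 1ℚ) (ℚₚ.+-monoʳ-≤ 1ℚ (fromℕℚ-mono-≤ {0} {a} z≤n)))

fromℕℚ≢0 : ∀ a → a ≢ 0 → fromℕℚ a ≢ 0ℚ
fromℕℚ≢0 zero    a≢0 = ⊥-elim (a≢0 refl)
fromℕℚ≢0 (suc a) _   = fromℕℚ-suc≢0 a

sumℚ-fromℕℚ : ∀ n (f : Fin n → ℕ) → sumℚ n (λ j → fromℕℚ (f j)) ≡ fromℕℚ (sumℕ n f)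
sumℚ-fromℕℚ zero    f = refl
sumℚ-fromℕℚ (suc n) f =
  trans (cong (fromℕℚ (f zero) +_) (sumℚ-fromℕℚ n (f ∘ suc))) (sym (fromℕℚ-+ (f zero) (sumℕ n (f ∘ suc))))

singleℚ : ∀ {n} → Fin n → ℚ → Fin n → ℚ
singleℚ x v j = if ⌊ j ≟ x ⌋ then v else 0ℚ

singleℚ-same : ∀ {n} (x : Fin n) v → singleℚ x v x ≡ v
singleℚ-same x v with x ≟ x
... | yes _  = refl
... | no x≢x = ⊥-elim (x≢x refl)

singleℚ-other : ∀ {n} {x j : Fin n} v → j ≢ x → singleℚ x v j ≡ 0ℚ
singleℚ-other {x = x} {j} v j≢x with j ≟ x
... | yes j≡x = ⊥-elim (j≢x j≡x)
... | no _    = refl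

sumℚ-singleℚ : ∀ n (x : Fin n) v → sumℚ n (singleℚ x v) ≡ v
sumℚ-singleℚ n x v = trans (sumℚ-single n x (λ j → singleℚ-other v)) (singleℚ-same x v)

singleℕ : ∀ {n} → Fin n → ℕ → Fin n → ℕ
singleℕ x v j = if ⌊ j ≟ x ⌋ then v else 0

singleℕ-same : ∀ {n} (x : Fin n) v → singleℕ x v x ≡ v
singleℕ-same x v with x ≟ x
... | yes _  = refl
... | no x≢x = ⊥-elim (x≢x refl)

singleℕ-other : ∀ {n} {x j : Fin n} v → j ≢ x → singleℕ x v j ≡ 0
singleℕ-other {x = x} {j} v j≢x with j ≟ x
... | yes j≡x = ⊥-elim (j≢x j≡x)
... | no _    = refl

sumℕ-singleℕ : ∀ n (x : Fin n) v → sumℕ n (singleℕ x v) ≡ v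
sumℕ-singleℕ n x v = trans (sumℕ-single n x (λ j → singleℕ-other v)) (singleℕ-same x v)

sumℚ-pair : ∀ n {i j : Fin n} (f : Fin n → ℚ) → i ≢ j → (∀ l → l ≢ i → l ≢ j → f l ≡ 0ℚ) →
            sumℚ n f ≡ f i + f j
sumℚ-pair n {i} {j} f i≢j f≗0 = begin
  sumℚ n f                                                ≡⟨ sumℚ-cong n split ⟩
  sumℚ n (λ l → singleℚ i (f i) l + singleℚ j (f j) l)    ≡⟨ sumℚ-distrib-+ n _ _ ⟩
  sumℚ n (singleℚ i (f i)) + sumℚ n (singleℚ j (f j))     ≡⟨ cong₂ _+_ (sumℚ-singleℚ n i (f i)) (sumℚ-singleℚ n j (f j)) ⟩
  f i + f j                                               ∎
  where
  open ≡-Reasoning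
  split : ∀ l → f l ≡ singleℚ i (f i) l + singleℚ j (f j) l
  split l = by-cases (l ≟ i) (l ≟ j)
    where
    by-cases : Dec (l ≡ i) → Dec (l ≡ j) → f l ≡ singleℚ i (f i) l + singleℚ j (f j) l
    by-cases (yes refl) _          = sym (trans (cong₂ _+_ (singleℚ-same l (f l)) (singleℚ-other (f j) i≢j)) (ℚₚ.+-identityʳ (f l)))
    by-cases (no l≢i)   (yes refl) = sym (trans (cong₂ _+_ (singleℚ-other (f i) l≢i) (singleℚ-same l (f l))) (ℚₚ.+-identityˡ (f l)))
    by-cases (no l≢i)   (no l≢j)   = trans (f≗0 l l≢i l≢j) (sym (cong₂ _+_ (singleℚ-other (f i) l≢i) (singleℚ-other (f j) l≢j)))

-- Linear algebra over ℚ

infix 8 _·_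
_·_ : ∀ {k} → (Fin k → ℚ) → (Fin k → ℚ) → ℚ
_·_ {k} c v = sumℚ k (λ t → c t * v t)

LinearlyIndependent : ∀ {k N} → (Fin N → Fin k → ℚ) → Set
LinearlyIndependent {k} {N} v =
  (μ : Fin N → ℚ) → (∀ t → sumℚ N (λ j → μ j * v j t) ≡ 0ℚ) → ∀ j → μ j ≡ 0ℚ

NontrivialAnnihilator : ∀ {k N} → (Fin N → Fin k → ℚ) → Set
NontrivialAnnihilator {k} w = Σ[ c ∈ (Fin k → ℚ) ] (∃[ t ] c t ≢ 0ℚ) × (∀ j → c · w j ≡ 0ℚ)

*-cancelʳ-≡0 : ∀ x p → p ≢ 0ℚ → x * p ≡ 0ℚ → x ≡ 0ℚ
*-cancelʳ-≡0 x p p≢0 xp≡0 = begin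
  x                  ≡⟨ sym (ℚₚ.*-identityʳ x) ⟩
  x * 1ℚ             ≡⟨ cong (x *_) (sym (ℚₚ.*-inverseʳ p)) ⟩
  x * (p * 1/ p)     ≡⟨ sym (ℚₚ.*-assoc x p (1/ p)) ⟩
  (x * p) * 1/ p     ≡⟨ cong (_* 1/ p) xp≡0 ⟩
  0ℚ * 1/ p          ≡⟨ ℚₚ.*-zeroˡ (1/ p) ⟩
  0ℚ                 ∎
  where
  open ≡-Reasoning
  instance _ = ℚ.≢-nonZero p≢0

≢0⇒≡0 : ∀ x → ¬ (x ≢ 0ℚ) → x ≡ 0ℚ
≢0⇒≡0 x ¬x≢0 with x ℚ.≟ 0ℚ
... | yes x≡0 = x≡0
... | no x≢0  = ⊥-elim (¬x≢0 x≢0)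

-- Gaussian elimination on the first coordinate, pivoting on the vector w js.
module Pivot {k N} (w : Fin N → Fin (suc k) → ℚ) (js : Fin N) (p≢0 : w js zero ≢ 0ℚ) where

  private
    p = w js zero
    instance _ = ℚ.≢-nonZero p≢0

  α : Fin N → ℚ
  α j = w j zero * 1/ p

  α*p : ∀ j → α j * p ≡ w j zero
  α*p j = begin
    w j zero * 1/ p * p     ≡⟨ ℚₚ.*-assoc (w j zero) (1/ p) p ⟩
    w j zero * (1/ p * p)   ≡⟨ cong (w j zero *_) (ℚₚ.*-inverseˡ p) ⟩
    w j zero * 1ℚ           ≡⟨ ℚₚ.*-identityʳ (w j zero) ⟩
    w j zero                ∎
    where open ≡-Reasoning

  reduced : Fin N → Fin k → ℚ
  reduced j t = w j (suc t) + - (α j * w js (suc t))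

  ·-reduced : ∀ (c : Fin k → ℚ) j →
              c · reduced j ≡ c · (w j ∘ suc) + - (α j * c · (w js ∘ suc))
  ·-reduced c j = begin
    sumℚ k (λ t → c t * (w j (suc t) + - (α j * w js (suc t))))
      ≡⟨ sumℚ-cong k (λ t → expand (c t) (w j (suc t)) (α j) (w js (suc t))) ⟩
    sumℚ k (λ t → c t * w j (suc t) + - (α j * (c t * w js (suc t))))
      ≡⟨ sumℚ-distrib-+ k _ _ ⟩
    c · (w j ∘ suc) + sumℚ k (λ t → - (α j * (c t * w js (suc t))))
      ≡⟨ cong (c · (w j ∘ suc) +_) (sym (trans (cong -_ (*-distribˡ-sumℚ k (α j) _))
                                                (neg-distrib-sumℚ k _))) ⟩
    c · (w j ∘ suc) + - (α j * c · (w js ∘ suc)) ∎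
    where
    open ≡-Reasoning
    expand : ∀ a x b y → a * (x + - (b * y)) ≡ a * x + - (b * (a * y))
    expand = solve 4 (λ a x b y → a :* (x :+ :- (b :* y)) := a :* x :+ :- (b :* (a :* y))) refl

  lift-annihilator : NontrivialAnnihilator reduced → NontrivialAnnihilator w
  lift-annihilator (c′ , (t , c′t≢0) , c′⊥) = c , (suc t , c′t≢0) , c⊥
    where
    D = c′ · (w js ∘ suc)
    c : Fin (suc k) → ℚ
    c zero    = - (D * 1/ p)
    c (suc t) = c′ t
    c⊥ : ∀ j → c · w j ≡ 0ℚ
    c⊥ j = begin
      - (D * 1/ p) * w j zero + c′ · (w j ∘ suc)   ≡⟨ cong (_+ c′ · (w j ∘ suc)) (rearrange D (1/ p) (w j zero)) ⟩
      - (α j * D) + c′ · (w j ∘ suc)               ≡⟨ ℚₚ.+-comm (- (α j * D)) (c′ · (w j ∘ suc)) ⟩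
      c′ · (w j ∘ suc) + - (α j * D)               ≡⟨ sym (·-reduced c′ j) ⟩
      c′ · reduced j                               ≡⟨ c′⊥ j ⟩
      0ℚ                                           ∎
      where
      open ≡-Reasoning
      rearrange : ∀ D q x → - (D * q) * x ≡ - ((x * q) * D)
      rearrange = solve 3 (λ D q x → (:- (D :* q)) :* x := :- ((x :* q) :* D)) refl

  pivotFirst : (Fin k → Fin N) → Fin (suc k) → Fin N
  pivotFirst s zero    = js
  pivotFirst s (suc l) = s l

  -- A vanishing combination μ of the vectors w ∘ pivotFirst s: with β = μ₀ + Σ μₗ α(s l), the first coordinate gives
  -- β p = 0, and the others then say that μ ∘ suc is a vanishing combination of the reduced vectors.
  module Combination (s : Fin k → Fin N) (μ : Fin (suc k) → ℚ)
                     (μw≡0 : ∀ t → sumℚ (suc k) (λ l → μ l * w (pivotFirst s l) t) ≡ 0ℚ) where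

    A : ℚ
    A = sumℚ k (λ l → μ (suc l) * α (s l))

    β : ℚ
    β = μ zero + A

    β≡0 : β ≡ 0ℚ
    β≡0 = *-cancelʳ-≡0 β p p≢0 (begin
      (μ zero + A) * p                                          ≡⟨ ℚₚ.*-distribʳ-+ p (μ zero) A ⟩
      μ zero * p + A * p                                        ≡⟨ cong (μ zero * p +_) A*p ⟩
      μ zero * p + sumℚ k (λ l → μ (suc l) * w (s l) zero)      ≡⟨ μw≡0 zero ⟩
      0ℚ                                                        ∎)
      where
      open ≡-Reasoning
      A*p : A * p ≡ sumℚ k (λ l → μ (suc l) * w (s l) zero)
      A*p = trans (*-distribʳ-sumℚ k p _)
              (sumℚ-cong k (λ l → trans (ℚₚ.*-assoc (μ (suc l)) (α (s l)) p) (cong (μ (suc l) *_) (α*p (s l)))))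

    μreduced≡0 : ∀ t → sumℚ k (λ l → μ (suc l) * reduced (s l) t) ≡ 0ℚ
    μreduced≡0 t = begin
      sumℚ k (λ l → μ (suc l) * (w (s l) (suc t) + - (α (s l) * y)))
        ≡⟨ sumℚ-cong k (λ l → expand (μ (suc l)) (w (s l) (suc t)) (α (s l)) y) ⟩
      sumℚ k (λ l → μ (suc l) * w (s l) (suc t) + - ((μ (suc l) * α (s l)) * y))
        ≡⟨ sumℚ-distrib-+ k _ _ ⟩
      B + sumℚ k (λ l → - ((μ (suc l) * α (s l)) * y))
        ≡⟨ cong (B +_) (sym (trans (cong -_ (*-distribʳ-sumℚ k y _)) (neg-distrib-sumℚ k _))) ⟩
      B + - (A * y)
        ≡⟨ regroup B (μ zero) A y ⟩
      (μ zero * y + B) + - (β * y)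
        ≡⟨ cong₂ (λ u v → u + - (v * y)) (μw≡0 (suc t)) β≡0 ⟩
      0ℚ + - (0ℚ * y)
        ≡⟨ cong (λ u → 0ℚ + - u) (ℚₚ.*-zeroˡ y) ⟩
      0ℚ ∎
      where
      open ≡-Reasoning
      y = w js (suc t)
      B = sumℚ k (λ l → μ (suc l) * w (s l) (suc t))
      expand : ∀ m x a y → m * (x + - (a * y)) ≡ m * x + - ((m * a) * y)
      expand = solve 4 (λ m x a y → m :* (x :+ (:- (a :* y))) := m :* x :+ (:- ((m :* a) :* y))) refl
      regroup : ∀ B m A y → B + - (A * y) ≡ (m * y + B) + - ((m + A) * y)
      regroup = solve 4 (λ B m A y → B :+ (:- (A :* y)) := (m :* y :+ B) :+ (:- ((m :+ A) :* y))) refl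

  lift-independent : ∀ (s : Fin k → Fin N) → LinearlyIndependent (reduced ∘ s) →
                     LinearlyIndependent (w ∘ pivotFirst s)
  lift-independent s indep μ μw≡0 = μ≡0
    where
    open Combination s μ μw≡0
    μsuc≡0 : ∀ l → μ (suc l) ≡ 0ℚ
    μsuc≡0 = indep (μ ∘ suc) μreduced≡0
    μ≡0 : ∀ j → μ j ≡ 0ℚ
    μ≡0 (suc l) = μsuc≡0 l
    μ≡0 zero    = begin
      μ zero        ≡⟨ sym (ℚₚ.+-identityʳ (μ zero)) ⟩
      μ zero + 0ℚ   ≡⟨ cong (μ zero +_) (sym (sumℚ-zero k (λ l → trans (cong (_* α (s l)) (μsuc≡0 l)) (ℚₚ.*-zeroˡ (α (s l)))))) ⟩
      β             ≡⟨ β≡0 ⟩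
      0ℚ            ∎
      where open ≡-Reasoning

first-coordinate-annihilator : ∀ {k N} (w : Fin N → Fin (suc k) → ℚ) → (∀ j → w j zero ≡ 0ℚ) →
                               NontrivialAnnihilator w
first-coordinate-annihilator {k} w w₀≡0 = e₀ , (zero , λ ()) , e₀⊥
  where
  e₀ : Fin (suc k) → ℚ
  e₀ zero    = 1ℚ
  e₀ (suc t) = 0ℚ
  e₀⊥ : ∀ j → e₀ · w j ≡ 0ℚ
  e₀⊥ j = cong₂ _+_ (trans (ℚₚ.*-identityˡ (w j zero)) (w₀≡0 j)) (sumℚ-zero k (λ t → ℚₚ.*-zeroˡ (w j (suc t))))

independent-or-annihilated : ∀ k N (w : Fin N → Fin k → ℚ) →
  (Σ[ s ∈ (Fin k → Fin N) ] LinearlyIndependent (w ∘ s)) ⊎ NontrivialAnnihilator w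
independent-or-annihilated zero    N w = inj₁ ((λ ()) , λ _ _ ())
independent-or-annihilated (suc k) N w with Finₚ.any? (λ j → ¬? (w j zero ℚ.≟ 0ℚ))
... | no noPivot        = inj₂ (first-coordinate-annihilator w (λ j → ≢0⇒≡0 (w j zero) (λ w₀≢0 → noPivot (j , w₀≢0))))
... | yes (js , p≢0) with independent-or-annihilated k N reduced
  where open Pivot w js p≢0
...   | inj₁ (s , indep) = inj₁ (pivotFirst s , lift-independent s indep)
  where open Pivot w js p≢0
...   | inj₂ ann         = inj₂ (lift-annihilator ann)
  where open Pivot w js p≢0

independent⇒injective : ∀ {k N} (v : Fin N → Fin k → ℚ) → LinearlyIndependent v → Injective _≡_ _≡_ v
independent⇒injective {k} {N} v indep {i} {j} vi≡vj with i ≟ j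
... | yes i≡j = i≡j
... | no i≢j  = ⊥-elim (1≢0 (trans (sym μi≡1) (indep μ μv≡0 i)))
  where
  1≢0 : 1ℚ ≢ 0ℚ
  1≢0 ()
  μ : Fin N → ℚ
  μ l = singleℚ i 1ℚ l + - singleℚ j 1ℚ l
  μi≡1 : μ i ≡ 1ℚ
  μi≡1 = cong₂ (λ a b → a + - b) (singleℚ-same i 1ℚ) (singleℚ-other 1ℚ i≢j)
  μj≡-1 : μ j ≡ - 1ℚ
  μj≡-1 = cong₂ (λ a b → a + - b) (singleℚ-other 1ℚ (i≢j ∘ sym)) (singleℚ-same j 1ℚ)
  μv≡0 : ∀ t → sumℚ N (λ l → μ l * v l t) ≡ 0ℚ
  μv≡0 t = begin
    sumℚ N (λ l → μ l * v l t)     ≡⟨ sumℚ-pair N (λ l → μ l * v l t) i≢j off ⟩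
    μ i * v i t + μ j * v j t      ≡⟨ cong₂ (λ a b → a * v i t + b) μi≡1 (cong₂ _*_ μj≡-1 (cong (λ u → u t) (sym vi≡vj))) ⟩
    1ℚ * v i t + - 1ℚ * v i t      ≡⟨ cancel (v i t) ⟩
    0ℚ                             ∎
    where
    open ≡-Reasoning
    off : ∀ l → l ≢ i → l ≢ j → μ l * v l t ≡ 0ℚ
    off l l≢i l≢j = trans (cong₂ (λ a b → (a + - b) * v l t) (singleℚ-other 1ℚ l≢i) (singleℚ-other 1ℚ l≢j))
                          (ℚₚ.*-zeroˡ (v l t))
    cancel : ∀ x → 1ℚ * x + - 1ℚ * x ≡ 0ℚ
    cancel = solve 1 (λ x → con 1ℚ :* x :+ con (- 1ℚ) :* x := con 0ℚ) refl

fewer-vectors-annihilated : ∀ {K N} → K < N → (R : Fin K → Fin N → ℚ) → NontrivialAnnihilator R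
fewer-vectors-annihilated {K} {N} K<N R with independent-or-annihilated N K R
... | inj₂ ann = ann
... | inj₁ (s , indep) with Finₚ.pigeonhole K<N s
...   | (i , j , i<j , si≡sj) = ⊥-elim (Finₚ.<-irrefl (independent⇒injective (R ∘ s) indep (cong R si≡sj)) i<j)

-- Graphs on Fin i: degrees, cloning, relabelling

𝟙 : Bool → ℕ
𝟙 b = if b then 1 else 0

𝟙ℚ : Bool → ℚ
𝟙ℚ b = if b then 1ℚ else 0ℚ

𝟙ℚ≡fromℕℚ𝟙 : ∀ b → 𝟙ℚ b ≡ fromℕℚ (𝟙 b)
𝟙ℚ≡fromℕℚ𝟙 true  = refl
𝟙ℚ≡fromℕℚ𝟙 false = refl

true≢false : true ≢ false
true≢false ()

<ᵇ-true : ∀ {m n} → m < n → (m <ᵇ n) ≡ true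
<ᵇ-true m<n = Equivalence.to Boolₚ.T-≡ (ℕₚ.<⇒<ᵇ m<n)

<ᵇ-false : ∀ {m n} → ¬ (m < n) → (m <ᵇ n) ≡ false
<ᵇ-false {m} {n} m≮n = Boolₚ.¬-not (λ m<ᵇn → m≮n (ℕₚ.<ᵇ⇒< m n (Equivalence.from Boolₚ.T-≡ m<ᵇn)))

upperℕ : ∀ {n} → (Fin n → Fin n → ℕ) → Fin n → Fin n → ℕ
upperℕ h j k = if toℕ j <ᵇ toℕ k then h j k else 0

upperℚ : ∀ {n} → (Fin n → Fin n → ℚ) → Fin n → Fin n → ℚ
upperℚ h j k = if toℕ j <ᵇ toℕ k then h j k else 0ℚ

upperℕ-split : ∀ {n} (h : Fin n → Fin n → ℕ) → (∀ j k → h j k ≡ h k j) → (∀ j → h j j ≡ 0) →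
               ∀ j k → h j k ≡ upperℕ h j k ℕ.+ upperℕ h k j
upperℕ-split h sym-h diag-h j k with Finₚ.<-cmp j k
... | tri< j<k _ k≮j rewrite <ᵇ-true j<k | <ᵇ-false k≮j = sym (ℕₚ.+-identityʳ (h j k))
... | tri≈ _ refl _  rewrite <ᵇ-false (ℕₚ.<-irrefl {toℕ j} refl) = diag-h j
... | tri> j≮k _ k<j rewrite <ᵇ-false j≮k | <ᵇ-true k<j = sym-h j k

sumℕ-symmetric : ∀ n (h : Fin n → Fin n → ℕ) → (∀ j k → h j k ≡ h k j) → (∀ j → h j j ≡ 0) →
                 let U = sumℕ n (λ j → sumℕ n (upperℕ h j)) in sumℕ n (λ j → sumℕ n (h j)) ≡ U ℕ.+ U
sumℕ-symmetric n h sym-h diag-h = begin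
  sumℕ n (λ j → sumℕ n (h j))
    ≡⟨ sumℕ-cong n (λ j → trans (sumℕ-cong n (upperℕ-split h sym-h diag-h j)) (sumℕ-distrib-+ n _ _)) ⟩
  sumℕ n (λ j → sumℕ n (upperℕ h j) ℕ.+ sumℕ n (λ k → upperℕ h k j))
    ≡⟨ sumℕ-distrib-+ n _ _ ⟩
  sumℕ n (λ j → sumℕ n (upperℕ h j)) ℕ.+ sumℕ n (λ j → sumℕ n (λ k → upperℕ h k j))
    ≡⟨ cong (sumℕ n (λ j → sumℕ n (upperℕ h j)) ℕ.+_) (sumℕ-comm n n (λ j k → upperℕ h k j)) ⟩
  sumℕ n (λ j → sumℕ n (upperℕ h j)) ℕ.+ sumℕ n (λ k → sumℕ n (upperℕ h k)) ∎
  where open ≡-Reasoning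

module _ {i : ℕ} where

  deg : Graph i → Fin i → ℕ
  deg H x = sumℕ i (λ y → 𝟙 (adj H x y))

  degreeSum : Graph i → ℕ
  degreeSum H = sumℕ i (deg H)

  handshake : ∀ H → degreeSum H ≡ edgeCount H ℕ.+ edgeCount H
  handshake H = trans (sumℕ-symmetric i (λ j k → 𝟙 (adj H j k)) (λ j k → cong 𝟙 (adj-sym H j k)) (λ j → cong 𝟙 (adj-irrefl H j)))
                      (cong (λ U → U ℕ.+ U) (sumℕ-cong i (λ j → sumℕ-cong i (upper≡ j))))
    where
    upper≡ : ∀ j k → upperℕ (λ j k → 𝟙 (adj H j k)) j k ≡ (if (toℕ j <ᵇ toℕ k) ∧ adj H j k then 1 else 0)
    upper≡ j k with toℕ j <ᵇ toℕ k
    ... | true  = refl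
    ... | false = refl

  AgreeOff : Fin i → Graph i → Graph i → Set
  AgreeOff w H′ H = ∀ x y → x ≢ w → y ≢ w → adj H′ x y ≡ adj H x y

  deg-agreeOff : ∀ w H′ H → AgreeOff w H′ H → ∀ x → x ≢ w →
                 deg H′ x ℕ.+ 𝟙 (adj H x w) ≡ deg H x ℕ.+ 𝟙 (adj H′ x w)
  deg-agreeOff w H′ H agree x x≢w = begin
    deg H′ x ℕ.+ 𝟙 (adj H x w)                              ≡⟨ cong (deg H′ x ℕ.+_) (sym (sumℕ-singleℕ i w _)) ⟩
    deg H′ x ℕ.+ sumℕ i (singleℕ w (𝟙 (adj H x w)))         ≡⟨ sym (sumℕ-distrib-+ i _ _) ⟩
    sumℕ i (λ y → 𝟙 (adj H′ x y) ℕ.+ singleℕ w (𝟙 (adj H x w)) y) ≡⟨ sumℕ-cong i exchange ⟩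
    sumℕ i (λ y → 𝟙 (adj H x y) ℕ.+ singleℕ w (𝟙 (adj H′ x w)) y) ≡⟨ sumℕ-distrib-+ i _ _ ⟩
    deg H x ℕ.+ sumℕ i (singleℕ w (𝟙 (adj H′ x w)))         ≡⟨ cong (deg H x ℕ.+_) (sumℕ-singleℕ i w _) ⟩
    deg H x ℕ.+ 𝟙 (adj H′ x w)                              ∎
    where
    open ≡-Reasoning
    exchange : ∀ y → 𝟙 (adj H′ x y) ℕ.+ singleℕ w (𝟙 (adj H x w)) y ≡ 𝟙 (adj H x y) ℕ.+ singleℕ w (𝟙 (adj H′ x w)) y
    exchange y with y ≟ w
    ... | yes refl = ℕₚ.+-comm (𝟙 (adj H′ x y)) (𝟙 (adj H x y))
    ... | no y≢w   = cong (λ b → 𝟙 b ℕ.+ 0) (agree x y x≢w y≢w)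

  -- Both sides count twice the edges avoiding w, plus 2 deg_H w + 2 deg_H′ w.
  degreeSum-agreeOff : ∀ w H′ H → AgreeOff w H′ H →
                       degreeSum H′ ℕ.+ (deg H w ℕ.+ deg H w) ≡ degreeSum H ℕ.+ (deg H′ w ℕ.+ deg H′ w)
  degreeSum-agreeOff w H′ H agree = begin
    degreeSum H′ ℕ.+ (deg H w ℕ.+ deg H w)
      ≡⟨ cong (λ d → degreeSum H′ ℕ.+ (d ℕ.+ deg H w)) (sym (column H)) ⟩
    degreeSum H′ ℕ.+ (sumℕ i (λ x → 𝟙 (adj H x w)) ℕ.+ deg H w)
      ≡⟨ cong (λ s → degreeSum H′ ℕ.+ (sumℕ i (λ x → 𝟙 (adj H x w)) ℕ.+ s)) (sym (sumℕ-singleℕ i w _)) ⟩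
    degreeSum H′ ℕ.+ (sumℕ i (λ x → 𝟙 (adj H x w)) ℕ.+ sumℕ i (singleℕ w (deg H w)))
      ≡⟨ sym (distrib₃ (deg H′) (λ x → 𝟙 (adj H x w)) (singleℕ w (deg H w))) ⟩
    sumℕ i (λ x → deg H′ x ℕ.+ (𝟙 (adj H x w) ℕ.+ singleℕ w (deg H w) x))
      ≡⟨ sumℕ-cong i exchange ⟩
    sumℕ i (λ x → deg H x ℕ.+ (𝟙 (adj H′ x w) ℕ.+ singleℕ w (deg H′ w) x))
      ≡⟨ distrib₃ (deg H) (λ x → 𝟙 (adj H′ x w)) (singleℕ w (deg H′ w)) ⟩
    degreeSum H ℕ.+ (sumℕ i (λ x → 𝟙 (adj H′ x w)) ℕ.+ sumℕ i (singleℕ w (deg H′ w)))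
      ≡⟨ cong₂ (λ d s → degreeSum H ℕ.+ (d ℕ.+ s)) (column H′) (sumℕ-singleℕ i w _) ⟩
    degreeSum H ℕ.+ (deg H′ w ℕ.+ deg H′ w) ∎
    where
    open ≡-Reasoning
    column : ∀ K → sumℕ i (λ x → 𝟙 (adj K x w)) ≡ deg K w
    column K = sumℕ-cong i (λ x → cong 𝟙 (adj-sym K x w))
    distrib₃ : ∀ f g h → sumℕ i (λ x → f x ℕ.+ (g x ℕ.+ h x)) ≡ sumℕ i f ℕ.+ (sumℕ i g ℕ.+ sumℕ i h)
    distrib₃ f g h = trans (sumℕ-distrib-+ i _ _) (cong (sumℕ i f ℕ.+_) (sumℕ-distrib-+ i g h))
    exchange : ∀ x → deg H′ x ℕ.+ (𝟙 (adj H x w) ℕ.+ singleℕ w (deg H w) x)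
                   ≡ deg H x ℕ.+ (𝟙 (adj H′ x w) ℕ.+ singleℕ w (deg H′ w) x)
    exchange x with x ≟ w
    ... | yes refl rewrite adj-irrefl H x | adj-irrefl H′ x = ℕₚ.+-comm (deg H′ x) (deg H x)
    ... | no x≢w   = trans (sym (ℕₚ.+-assoc (deg H′ x) _ 0))
                           (trans (cong (ℕ._+ 0) (deg-agreeOff w H′ H agree x x≢w)) (ℕₚ.+-assoc (deg H x) _ 0))

  deg+1≡sum : ∀ H x → deg H x ℕ.+ 1 ≡ sumℕ i (λ y → 𝟙 (adj H x y) ℕ.+ singleℕ x 1 y)
  deg+1≡sum H x = trans (cong (deg H x ℕ.+_) (sym (sumℕ-singleℕ i x 1))) (sym (sumℕ-distrib-+ i _ _))

  deg<order : ∀ H x → deg H x < i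
  deg<order H x = begin
    suc (deg H x)                                             ≡⟨ ℕₚ.+-comm 1 (deg H x) ⟩
    deg H x ℕ.+ 1                                             ≡⟨ deg+1≡sum H x ⟩
    sumℕ i (λ y → 𝟙 (adj H x y) ℕ.+ singleℕ x 1 y)            ≤⟨ sumℕ-mono-≤ i at-most-one ⟩
    sumℕ i (λ _ → 1)                                          ≡⟨ sumℕ-count i ⟩
    i                                                         ∎
    where
    open ℕₚ.≤-Reasoning
    at-most-one : ∀ y → 𝟙 (adj H x y) ℕ.+ singleℕ x 1 y ≤ 1
    at-most-one y with y ≟ x
    ... | yes refl rewrite adj-irrefl H y = ℕₚ.≤-refl
    ... | no _ with adj H x y
    ...   | true  = ℕₚ.≤-refl
    ...   | false = z≤n

  deg-full : ∀ H x → (∀ y → y ≢ x → adj H x y ≡ true) → deg H x ℕ.+ 1 ≡ i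
  deg-full H x full = trans (deg+1≡sum H x) (trans (sumℕ-cong i exactly-one) (sumℕ-count i))
    where
    exactly-one : ∀ y → 𝟙 (adj H x y) ℕ.+ singleℕ x 1 y ≡ 1
    exactly-one y with y ≟ x
    ... | yes refl rewrite adj-irrefl H y = refl
    ... | no y≢x   rewrite full y y≢x     = refl

  -- clone H w z turns w into a non-adjacent twin of z (Zykov symmetrization).
  clone : Graph i → Fin i → Fin i → Graph i
  clone H w z = record { adj = adjᶜ ; adj-sym = sym-adjᶜ ; adj-irrefl = irrefl-adjᶜ }
    where
    adjᶜ : EdgeRel i
    adjᶜ x y with x ≟ w | y ≟ w
    ... | yes _ | yes _ = false
    ... | yes _ | no _  = adj H z y
    ... | no _  | yes _ = adj H z x
    ... | no _  | no _  = adj H x y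
    sym-adjᶜ : ∀ x y → adjᶜ x y ≡ adjᶜ y x
    sym-adjᶜ x y with x ≟ w | y ≟ w
    ... | yes _ | yes _ = refl
    ... | yes _ | no _  = refl
    ... | no _  | yes _ = refl
    ... | no _  | no _  = adj-sym H x y
    irrefl-adjᶜ : ∀ x → adjᶜ x x ≡ false
    irrefl-adjᶜ x with x ≟ w
    ... | yes _ = refl
    ... | no _  = adj-irrefl H x

  clone-agreeOff : ∀ H w z → AgreeOff w (clone H w z) H
  clone-agreeOff H w z x y x≢w y≢w with x ≟ w | y ≟ w
  ... | yes x≡w | _       = ⊥-elim (x≢w x≡w)
  ... | no _    | yes y≡w = ⊥-elim (y≢w y≡w)
  ... | no _    | no _    = refl

  clone-row : ∀ H w z y → y ≢ w → adj (clone H w z) w y ≡ adj H z y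
  clone-row H w z y y≢w with w ≟ w | y ≟ w
  ... | no w≢w | _       = ⊥-elim (w≢w refl)
  ... | yes _  | yes y≡w = ⊥-elim (y≢w y≡w)
  ... | yes _  | no _    = refl

  clone-col : ∀ H w z x → x ≢ w → adj (clone H w z) x w ≡ adj H z x
  clone-col H w z x x≢w = trans (adj-sym (clone H w z) x w) (clone-row H w z x x≢w)

  deg-clone-self : ∀ H w z → deg (clone H w z) w ℕ.+ 𝟙 (adj H z w) ≡ deg H z
  deg-clone-self H w z = begin
    deg (clone H w z) w ℕ.+ 𝟙 (adj H z w)                               ≡⟨ cong (deg (clone H w z) w ℕ.+_) (sym (sumℕ-singleℕ i w _)) ⟩
    deg (clone H w z) w ℕ.+ sumℕ i (singleℕ w (𝟙 (adj H z w)))          ≡⟨ sym (sumℕ-distrib-+ i _ _) ⟩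
    sumℕ i (λ y → 𝟙 (adj (clone H w z) w y) ℕ.+ singleℕ w (𝟙 (adj H z w)) y) ≡⟨ sumℕ-cong i row ⟩
    deg H z                                                            ∎
    where
    open ≡-Reasoning
    row : ∀ y → 𝟙 (adj (clone H w z) w y) ℕ.+ singleℕ w (𝟙 (adj H z w)) y ≡ 𝟙 (adj H z y)
    row y = by-cases (y ≟ w)
      where
      by-cases : Dec (y ≡ w) → 𝟙 (adj (clone H w z) w y) ℕ.+ singleℕ w (𝟙 (adj H z w)) y ≡ 𝟙 (adj H z y)
      by-cases (yes refl) = cong₂ ℕ._+_ (cong 𝟙 (adj-irrefl (clone H w z) w)) (singleℕ-same w _)
      by-cases (no y≢w)   = trans (cong₂ ℕ._+_ (cong 𝟙 (clone-row H w z y y≢w)) (singleℕ-other _ y≢w)) (ℕₚ.+-identityʳ _)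

  deg-clone-other : ∀ H w z x → x ≢ w → deg (clone H w z) x ℕ.+ 𝟙 (adj H x w) ≡ deg H x ℕ.+ 𝟙 (adj H z x)
  deg-clone-other H w z x x≢w =
    trans (deg-agreeOff w (clone H w z) H (clone-agreeOff H w z) x x≢w) (cong (λ b → deg H x ℕ.+ 𝟙 b) (clone-col H w z x x≢w))

  relabel : Graph i → Permutation′ i → Graph i
  relabel H π = record
    { adj        = λ x y → adj H (π ⟨$⟩ʳ x) (π ⟨$⟩ʳ y)
    ; adj-sym    = λ x y → adj-sym H (π ⟨$⟩ʳ x) (π ⟨$⟩ʳ y)
    ; adj-irrefl = λ x → adj-irrefl H (π ⟨$⟩ʳ x)
    }

  deg-relabel : ∀ H π x → deg (relabel H π) x ≡ deg H (π ⟨$⟩ʳ x)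
  deg-relabel H π x = sumℕ-permute i (λ y → 𝟙 (adj H (π ⟨$⟩ʳ x) y)) π

  degreeSum-relabel : ∀ H π → degreeSum (relabel H π) ≡ degreeSum H
  degreeSum-relabel H π = trans (sumℕ-cong i (deg-relabel H π)) (sumℕ-permute i (deg H) π)

  makeUniversal : Graph i → Fin i → Graph i
  makeUniversal H w = record { adj = adjᵘ ; adj-sym = sym-adjᵘ ; adj-irrefl = irrefl-adjᵘ }
    where
    adjᵘ : EdgeRel i
    adjᵘ x y with x ≟ w | y ≟ w
    ... | yes _ | yes _ = false
    ... | yes _ | no _  = true
    ... | no _  | yes _ = true
    ... | no _  | no _  = adj H x y
    sym-adjᵘ : ∀ x y → adjᵘ x y ≡ adjᵘ y x
    sym-adjᵘ x y with x ≟ w | y ≟ w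
    ... | yes _ | yes _ = refl
    ... | yes _ | no _  = refl
    ... | no _  | yes _ = refl
    ... | no _  | no _  = adj-sym H x y
    irrefl-adjᵘ : ∀ x → adjᵘ x x ≡ false
    irrefl-adjᵘ x with x ≟ w
    ... | yes _ = refl
    ... | no _  = adj-irrefl H x

  makeUniversal-agreeOff : ∀ H w → AgreeOff w (makeUniversal H w) H
  makeUniversal-agreeOff H w x y x≢w y≢w with x ≟ w | y ≟ w
  ... | yes x≡w | _       = ⊥-elim (x≢w x≡w)
  ... | no _    | yes y≡w = ⊥-elim (y≢w y≡w)
  ... | no _    | no _    = refl

  deg-makeUniversal : ∀ H w → deg (makeUniversal H w) w ℕ.+ 1 ≡ i
  deg-makeUniversal H w = deg-full (makeUniversal H w) w row
    where
    row : ∀ y → y ≢ w → adj (makeUniversal H w) w y ≡ true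
    row y y≢w with w ≟ w | y ≟ w
    ... | no w≢w | _       = ⊥-elim (w≢w refl)
    ... | yes _  | yes y≡w = ⊥-elim (y≢w y≡w)
    ... | yes _  | no _    = refl

-- Extremal a-clique-free graphs

⟨$⟩ʳ-injective : ∀ {n} (π : Permutation′ n) → Injective _≡_ _≡_ (π ⟨$⟩ʳ_)
⟨$⟩ʳ-injective π {x} {y} πx≡πy = trans (sym (inverseˡ π)) (trans (cong (π ⟨$⟩ˡ_) πx≡πy) (inverseˡ π))

module _ {i : ℕ} where

  CliqueFree : ℕ → Graph i → Set
  CliqueFree a H = ¬ HasClique a (adj H)

  relabel-cliqueFree : ∀ {a} H π → CliqueFree a H → CliqueFree a (relabel H π)
  relabel-cliqueFree H π free (f , f-inj , f-clique) =
    free ((π ⟨$⟩ʳ_) ∘ f , f-inj ∘ ⟨$⟩ʳ-injective π , f-clique)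

  -- A clique through the twin w of z becomes a clique of H once w is replaced by z.
  clone-cliqueFree : ∀ {a} H w z → z ≢ w → CliqueFree a H → CliqueFree a (clone H w z)
  clone-cliqueFree H w z z≢w free (f , f-inj , f-clique) with Finₚ.any? (λ j → f j ≟ w)
  ... | no w∉f = free (f , f-inj , λ j k j≢k →
          trans (sym (clone-agreeOff H w z (f j) (f k) (λ e → w∉f (j , e)) (λ e → w∉f (k , e)))) (f-clique j k j≢k))
  ... | yes (j₀ , fj₀≡w) = free (f′ , f′-inj , f′-clique)
    where
    f′ = updateAt f j₀ (const z)
    f′-j₀ : f′ j₀ ≡ z
    f′-j₀ = updateAt-updates j₀ f
    f′-other : ∀ {j} → j ≢ j₀ → f′ j ≡ f j
    f′-other {j} j≢j₀ = updateAt-minimal j j₀ f j≢j₀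
    other≢w : ∀ {j} → j ≢ j₀ → f j ≢ w
    other≢w j≢j₀ fj≡w = j≢j₀ (f-inj (trans fj≡w (sym fj₀≡w)))
    z~other : ∀ {j} → j ≢ j₀ → adj H z (f j) ≡ true
    z~other {j} j≢j₀ = begin
      adj H z (f j)                    ≡⟨ sym (clone-row H w z (f j) (other≢w j≢j₀)) ⟩
      adj (clone H w z) w (f j)        ≡⟨ cong (λ u → adj (clone H w z) u (f j)) (sym fj₀≡w) ⟩
      adj (clone H w z) (f j₀) (f j)   ≡⟨ f-clique j₀ j (j≢j₀ ∘ sym) ⟩
      true                             ∎
      where open ≡-Reasoning
    z∉f : ∀ j → f j ≢ z
    z∉f j fj≡z with j ≟ j₀
    ... | yes refl = z≢w (trans (sym fj≡z) fj₀≡w)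
    ... | no j≢j₀  = true≢false (trans (sym (z~other j≢j₀)) (trans (cong (adj H z) fj≡z) (adj-irrefl H z)))
    f′-inj : Injective _≡_ _≡_ f′
    f′-inj {j} {k} f′j≡f′k with j ≟ j₀ | k ≟ j₀
    ... | yes j≡j₀ | yes k≡j₀ = trans j≡j₀ (sym k≡j₀)
    ... | yes refl | no k≢j₀  = ⊥-elim (z∉f k (trans (sym (f′-other k≢j₀)) (trans (sym f′j≡f′k) f′-j₀)))
    ... | no j≢j₀  | yes refl = ⊥-elim (z∉f j (trans (sym (f′-other j≢j₀)) (trans f′j≡f′k f′-j₀)))
    ... | no j≢j₀  | no k≢j₀  = f-inj (trans (sym (f′-other j≢j₀)) (trans f′j≡f′k (f′-other k≢j₀)))
    f′-clique : ∀ j k → j ≢ k → adj H (f′ j) (f′ k) ≡ true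
    f′-clique j k j≢k with j ≟ j₀ | k ≟ j₀
    ... | yes j≡j₀ | yes k≡j₀ = ⊥-elim (j≢k (trans j≡j₀ (sym k≡j₀)))
    ... | yes refl | no k≢j₀  = trans (cong₂ (adj H) f′-j₀ (f′-other k≢j₀)) (z~other k≢j₀)
    ... | no j≢j₀  | yes refl = trans (cong₂ (adj H) (f′-other j≢j₀) f′-j₀) (trans (adj-sym H (f j) z) (z~other j≢j₀))
    ... | no j≢j₀  | no k≢j₀  = trans (cong₂ (adj H) (f′-other j≢j₀) (f′-other k≢j₀))
                                      (trans (sym (clone-agreeOff H w z (f j) (f k) (other≢w j≢j₀) (other≢w k≢j₀))) (f-clique j k j≢k))

compensate-≤ : ∀ {A B X Y} → A ℕ.+ X ≡ B ℕ.+ Y → A ≤ B → Y ≤ X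
compensate-≤ {A} {B} {X} {Y} eq A≤B =
  ℕₚ.+-cancelˡ-≤ B Y X (ℕₚ.≤-trans (ℕₚ.≤-reflexive (sym eq)) (ℕₚ.+-monoˡ-≤ X A≤B))

double-cancel-≤ : ∀ {m n} → m ℕ.+ m ≤ n ℕ.+ n → m ≤ n
double-cancel-≤ {m} {n} m+m≤n+n with ℕₚ.≤-<-connex m n
... | inj₁ m≤n = m≤n
... | inj₂ n<m = ⊥-elim (ℕₚ.<-irrefl refl (ℕₚ.<-≤-trans (ℕₚ.+-mono-< n<m n<m) m+m≤n+n))

double-injective : ∀ {m n} → m ℕ.+ m ≡ n ℕ.+ n → m ≡ n
double-injective eq = ℕₚ.≤-antisym (double-cancel-≤ (ℕₚ.≤-reflexive eq)) (double-cancel-≤ (ℕₚ.≤-reflexive (sym eq)))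

module ExtremalGraphs {i : ℕ} (a m : ℕ) (ex-bound : ∀ (H : Graph i) → CliqueFree a H → edgeCount H ≤ m) where

  record Extremal (H : Graph i) : Set where
    constructor extremal
    field
      cliqueFree : CliqueFree a H
      degreeSum≡ : degreeSum H ≡ m ℕ.+ m

  degreeSum≤ : ∀ H → CliqueFree a H → degreeSum H ≤ m ℕ.+ m
  degreeSum≤ H free = ℕₚ.≤-trans (ℕₚ.≤-reflexive (handshake H)) (ℕₚ.+-mono-≤ (ex-bound H free) (ex-bound H free))

  deg-clone-self≤ : ∀ {H} x z → Extremal H → z ≢ x → deg (clone H x z) x ≤ deg H x
  deg-clone-self≤ {H} x z (extremal free sum≡) z≢x = double-cancel-≤ (compensate-≤
    (degreeSum-agreeOff x (clone H x z) H (clone-agreeOff H x z))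
    (ℕₚ.≤-trans (degreeSum≤ (clone H x z) (clone-cliqueFree H x z z≢x free)) (ℕₚ.≤-reflexive (sym sum≡))))

  deg-clone-self-nonadjacent : ∀ (H : Graph i) x z → adj H x z ≡ false → deg (clone H x z) x ≡ deg H z
  deg-clone-self-nonadjacent H x z x≁z = begin
    deg (clone H x z) x                        ≡⟨ sym (ℕₚ.+-identityʳ _) ⟩
    deg (clone H x z) x ℕ.+ 𝟙 false            ≡⟨ cong (λ b → deg (clone H x z) x ℕ.+ 𝟙 b) (sym (trans (adj-sym H z x) x≁z)) ⟩
    deg (clone H x z) x ℕ.+ 𝟙 (adj H z x)      ≡⟨ deg-clone-self H x z ⟩
    deg H z                                    ∎
    where open ≡-Reasoning

  deg-clone-self-adjacent : ∀ (H : Graph i) x z → adj H x z ≡ true → deg (clone H x z) x ℕ.+ 1 ≡ deg H z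
  deg-clone-self-adjacent H x z x~z =
    trans (cong (λ b → deg (clone H x z) x ℕ.+ 𝟙 b) (sym (trans (adj-sym H z x) x~z))) (deg-clone-self H x z)

  nonadjacent⇒deg≥ : ∀ {H} x z → Extremal H → x ≢ z → adj H x z ≡ false → deg H z ≤ deg H x
  nonadjacent⇒deg≥ {H} x z ext x≢z x≁z =
    subst (_≤ deg H x) (deg-clone-self-nonadjacent H x z x≁z) (deg-clone-self≤ x z ext (x≢z ∘ sym))

  nonadjacent⇒deg≡ : ∀ {H} x z → Extremal H → x ≢ z → adj H x z ≡ false → deg H x ≡ deg H z
  nonadjacent⇒deg≡ {H} x z ext x≢z x≁z = ℕₚ.≤-antisym
    (nonadjacent⇒deg≥ z x ext (x≢z ∘ sym) (trans (adj-sym H z x) x≁z)) (nonadjacent⇒deg≥ x z ext x≢z x≁z)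

  adjacent⇒deg≤suc : ∀ {H} x z → Extremal H → x ≢ z → adj H x z ≡ true → deg H z ≤ suc (deg H x)
  adjacent⇒deg≤suc {H} x z ext x≢z x~z = begin
    deg H z                        ≡⟨ sym (deg-clone-self-adjacent H x z x~z) ⟩
    deg (clone H x z) x ℕ.+ 1      ≡⟨ ℕₚ.+-comm _ 1 ⟩
    suc (deg (clone H x z) x)      ≤⟨ s≤s (deg-clone-self≤ x z ext (x≢z ∘ sym)) ⟩
    suc (deg H x)                  ∎
    where open ℕₚ.≤-Reasoning

  clone-extremal : ∀ {H} x z → Extremal H → z ≢ x → deg (clone H x z) x ≡ deg H x → Extremal (clone H x z)
  clone-extremal {H} x z (extremal free sum≡) z≢x deg≡ = extremal (clone-cliqueFree H x z z≢x free) (trans sum-clone≡ sum≡)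
    where
    sum-clone≡ : degreeSum (clone H x z) ≡ degreeSum H
    sum-clone≡ = ℕₚ.+-cancelʳ-≡ (deg H x ℕ.+ deg H x) _ _
      (trans (degreeSum-agreeOff x (clone H x z) H (clone-agreeOff H x z)) (cong (λ d → degreeSum H ℕ.+ (d ℕ.+ d)) deg≡))

  clone-extremal-adjacent : ∀ {H} x z → Extremal H → x ≢ z → adj H x z ≡ true → deg H z ≡ suc (deg H x) →
                            Extremal (clone H x z)
  clone-extremal-adjacent {H} x z ext x≢z x~z deg≡ = clone-extremal x z ext (x≢z ∘ sym)
    (ℕₚ.suc-injective (trans (ℕₚ.+-comm 1 _) (trans (deg-clone-self-adjacent H x z x~z) deg≡)))

  -- If x ≁ y ≁ z but x ~ z, cloning y onto x keeps H extremal and then z ≁ y forces two different degrees of z to agree.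
  nonadjacent-trans : ∀ {H} x y z → Extremal H → x ≢ y → y ≢ z → x ≢ z →
                      adj H x y ≡ false → adj H y z ≡ false → adj H x z ≡ false
  nonadjacent-trans {H} x y z ext x≢y y≢z x≢z x≁y y≁z with adj H x z in x?z
  ... | false = refl
  ... | true  = ⊥-elim (ℕₚ.1+n≢n contradiction)
    where
    C = clone H x y
    deg-C-x : deg C x ≡ deg H x
    deg-C-x = trans (deg-clone-self-nonadjacent H x y x≁y) (sym (nonadjacent⇒deg≡ x y ext x≢y x≁y))
    C-extremal : Extremal C
    C-extremal = clone-extremal x y ext (x≢y ∘ sym) deg-C-x
    deg-C-z : deg C z ℕ.+ 1 ≡ deg H z
    deg-C-z = begin
      deg C z ℕ.+ 1                  ≡⟨ cong (λ b → deg C z ℕ.+ 𝟙 b) (sym (trans (adj-sym H z x) x?z)) ⟩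
      deg C z ℕ.+ 𝟙 (adj H z x)      ≡⟨ deg-clone-other H x y z (x≢z ∘ sym) ⟩
      deg H z ℕ.+ 𝟙 (adj H y z)      ≡⟨ cong (λ b → deg H z ℕ.+ 𝟙 b) y≁z ⟩
      deg H z ℕ.+ 0                  ≡⟨ ℕₚ.+-identityʳ _ ⟩
      deg H z                        ∎
      where open ≡-Reasoning
    deg-C-y : deg C y ≡ deg H y
    deg-C-y = begin
      deg C y                        ≡⟨ sym (ℕₚ.+-identityʳ _) ⟩
      deg C y ℕ.+ 𝟙 false            ≡⟨ cong (λ b → deg C y ℕ.+ 𝟙 b) (sym (trans (adj-sym H y x) x≁y)) ⟩
      deg C y ℕ.+ 𝟙 (adj H y x)      ≡⟨ deg-clone-other H x y y (x≢y ∘ sym) ⟩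
      deg H y ℕ.+ 𝟙 (adj H y y)      ≡⟨ cong (λ b → deg H y ℕ.+ 𝟙 b) (adj-irrefl H y) ⟩
      deg H y ℕ.+ 0                  ≡⟨ ℕₚ.+-identityʳ _ ⟩
      deg H y                        ∎
      where open ≡-Reasoning
    C-y≁z : adj C y z ≡ false
    C-y≁z = trans (clone-agreeOff H x y y z (x≢y ∘ sym) (x≢z ∘ sym)) y≁z
    contradiction : suc (deg C z) ≡ deg C z
    contradiction = begin
      suc (deg C z)     ≡⟨ ℕₚ.+-comm 1 _ ⟩
      deg C z ℕ.+ 1     ≡⟨ deg-C-z ⟩
      deg H z           ≡⟨ sym (nonadjacent⇒deg≡ y z ext y≢z y≁z) ⟩
      deg H y           ≡⟨ sym deg-C-y ⟩
      deg C y           ≡⟨ nonadjacent⇒deg≡ y z C-extremal y≢z C-y≁z ⟩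
      deg C z           ∎
      where open ≡-Reasoning

module _ {i : ℕ} where

  SamePart : Graph i → Fin i → Fin i → Set
  SamePart H y x = (y ≡ x) ⊎ (adj H y x ≡ false)

  samePart? : Graph i → Fin i → Fin i → Bool
  samePart? H y x = ⌊ y ≟ x ⌋ ∨ not (adj H y x)

  samePart?-sound : ∀ H y x → samePart? H y x ≡ true → SamePart H y x
  samePart?-sound H y x eq with y ≟ x | adj H y x
  ... | yes y≡x | _     = inj₁ y≡x
  ... | no _    | false = inj₂ refl

  samePart?-complete : ∀ H y x → SamePart H y x → samePart? H y x ≡ true
  samePart?-complete H y x (inj₁ refl) with y ≟ y
  ... | yes _  = refl
  ... | no y≢y = ⊥-elim (y≢y refl)
  samePart?-complete H y x (inj₂ y≁x) with y ≟ x
  ... | yes _ = refl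
  ... | no _ rewrite y≁x = refl

  deg+partSize≡order : ∀ H x → deg H x ℕ.+ sumℕ i (λ y → 𝟙 (samePart? H y x)) ≡ i
  deg+partSize≡order H x = trans (sym (sumℕ-distrib-+ i _ _)) (trans (sumℕ-cong i exactly-one) (sumℕ-count i))
    where
    exactly-one : ∀ y → 𝟙 (adj H x y) ℕ.+ 𝟙 (samePart? H y x) ≡ 1
    exactly-one y with y ≟ x
    ... | yes refl rewrite adj-irrefl H y = refl
    ... | no _ rewrite adj-sym H x y with adj H y x
    ...   | true  = refl
    ...   | false = refl

  -- Built greedily, K is a maximal clique: every listed vertex is equal or non-adjacent to a vertex of K.
  record CliqueTransversal (H : Graph i) (xs : List (Fin i)) : Set where
    field
      p        : ℕ
      K        : Fin p → Fin i
      K-inj    : Injective _≡_ _≡_ K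
      K-clique : ∀ j k → j ≢ k → adj H (K j) (K k) ≡ true
      K-meets  : ∀ {x} → x ∈ xs → Σ[ k ∈ Fin p ] SamePart H x (K k)

  greedyClique : ∀ H xs → CliqueTransversal H xs
  greedyClique H [] = record { p = 0 ; K = λ () ; K-inj = λ {j} → ⊥-elim (Finₚ.¬Fin0 j) ; K-clique = λ () ; K-meets = λ () }
  greedyClique H (x ∷ xs) with greedyClique H xs
  ... | T with Finₚ.all? (λ k → adj H x (CliqueTransversal.K T k) Bool.≟ true)
  ...   | yes x~K = record { p = suc p ; K = K′ ; K-inj = K′-inj ; K-clique = K′-clique ; K-meets = K′-meets }
    where
    open CliqueTransversal T
    K′ : Fin (suc p) → Fin i
    K′ zero    = x
    K′ (suc k) = K k
    x∉K : ∀ k → x ≢ K k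
    x∉K k x≡Kk = true≢false (trans (sym (x~K k)) (trans (cong (adj H x) (sym x≡Kk)) (adj-irrefl H x)))
    K′-inj : Injective _≡_ _≡_ K′
    K′-inj {zero}  {zero}  _ = refl
    K′-inj {zero}  {suc k} e = ⊥-elim (x∉K k e)
    K′-inj {suc j} {zero}  e = ⊥-elim (x∉K j (sym e))
    K′-inj {suc j} {suc k} e = cong suc (K-inj e)
    K′-clique : ∀ j k → j ≢ k → adj H (K′ j) (K′ k) ≡ true
    K′-clique zero    zero    j≢k = ⊥-elim (j≢k refl)
    K′-clique zero    (suc k) _   = x~K k
    K′-clique (suc j) zero    _   = trans (adj-sym H (K j) x) (x~K j)
    K′-clique (suc j) (suc k) j≢k = K-clique j k (j≢k ∘ cong suc)
    K′-meets : ∀ {y} → y ∈ x ∷ xs → Σ[ k ∈ Fin (suc p) ] SamePart H y (K′ k)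
    K′-meets (here refl) = zero , inj₁ refl
    K′-meets (there y∈xs) with K-meets y∈xs
    ... | k , same = suc k , same
  ...   | no ¬x~K = record { CliqueTransversal T ; K-meets = K′-meets }
    where
    open CliqueTransversal T
    witness = Finₚ.¬∀⟶∃¬ p (λ k → adj H x (K k) ≡ true) (λ k → adj H x (K k) Bool.≟ true) ¬x~K
    K′-meets : ∀ {y} → y ∈ x ∷ xs → Σ[ k ∈ Fin p ] SamePart H y (K k)
    K′-meets (here refl)  = proj₁ witness , inj₂ (Boolₚ.¬-not (proj₂ witness))
    K′-meets (there y∈xs) = K-meets y∈xs

module ExtremalStructure {i : ℕ} (a m : ℕ) (ex-bound : ∀ (H : Graph i) → CliqueFree a H → edgeCount H ≤ m)
                         {H : Graph i} (ext : ExtremalGraphs.Extremal a m ex-bound H) where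
  open ExtremalGraphs a m ex-bound

  samePart-sym : ∀ {x y} → SamePart H x y → SamePart H y x
  samePart-sym (inj₁ x≡y) = inj₁ (sym x≡y)
  samePart-sym {x} {y} (inj₂ x≁y) = inj₂ (trans (adj-sym H y x) x≁y)

  samePart-trans : ∀ {x y z} → SamePart H x y → SamePart H y z → SamePart H x z
  samePart-trans (inj₁ refl) s = s
  samePart-trans s (inj₁ refl) = s
  samePart-trans {x} {y} {z} (inj₂ x≁y) (inj₂ y≁z) with x ≟ y | y ≟ z | x ≟ z
  ... | _        | _        | yes x≡z = inj₁ x≡z
  ... | yes refl | _        | no _    = inj₂ y≁z
  ... | no _     | yes refl | no _    = inj₂ x≁y
  ... | no x≢y   | no y≢z   | no x≢z  = inj₂ (nonadjacent-trans x y z ext x≢y y≢z x≢z x≁y y≁z)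

  open CliqueTransversal (greedyClique H (allFin i))

  part : Fin i → Fin p
  part x = proj₁ (K-meets (∈-allFin x))

  in-part : ∀ x → SamePart H x (K (part x))
  in-part x = proj₂ (K-meets (∈-allFin x))

  part-unique : ∀ y k → SamePart H y (K k) → part y ≡ k
  part-unique y k same with k ≟ part y
  ... | yes k≡part = sym k≡part
  ... | no k≢part with samePart-trans (samePart-sym same) (in-part y)
  ...   | inj₁ Kk≡K = ⊥-elim (k≢part (K-inj Kk≡K))
  ...   | inj₂ Kk≁K = ⊥-elim (true≢false (trans (sym (K-clique k (part y) k≢part)) Kk≁K))

  single-part : ∀ y k → singleℕ (part y) 1 k ≡ 𝟙 (samePart? H y (K k))
  single-part y k = by-cases (k ≟ part y)
    where
    by-cases : Dec (k ≡ part y) → singleℕ (part y) 1 k ≡ 𝟙 (samePart? H y (K k))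
    by-cases (yes refl) = trans (singleℕ-same k 1) (sym (cong 𝟙 (samePart?-complete H y (K k) (in-part y))))
    by-cases (no k≢part) with samePart? H y (K k) in eq
    ... | true  = ⊥-elim (k≢part (sym (part-unique y k (samePart?-sound H y (K k) eq))))
    ... | false = singleℕ-other 1 k≢part

  order≡sum-partSizes : i ≡ sumℕ p (λ k → sumℕ i (λ y → 𝟙 (samePart? H y (K k))))
  order≡sum-partSizes = begin
    i                                                    ≡⟨ sym (sumℕ-count i) ⟩
    sumℕ i (λ y → 1)                                     ≡⟨ sumℕ-cong i (λ y → sym (sumℕ-singleℕ p (part y) 1)) ⟩
    sumℕ i (λ y → sumℕ p (singleℕ (part y) 1))           ≡⟨ sumℕ-comm i p _ ⟩
    sumℕ p (λ k → sumℕ i (λ y → singleℕ (part y) 1 k))   ≡⟨ sumℕ-cong p (λ k → sumℕ-cong i (λ y → single-part y k)) ⟩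
    sumℕ p (λ k → sumℕ i (λ y → 𝟙 (samePart? H y (K k)))) ∎
    where open ≡-Reasoning

  p<a : p < a
  p<a with ℕₚ.<-≤-connex p a
  ... | inj₁ p<a = p<a
  ... | inj₂ a≤p = ⊥-elim (Extremal.cliqueFree ext
          ( (λ j → K (Fin.inject≤ j a≤p))
          , (λ e → Finₚ.inject≤-injective a≤p a≤p _ _ (K-inj e))
          , (λ j k j≢k → K-clique _ _ (j≢k ∘ Finₚ.inject≤-injective a≤p a≤p _ _))))

  -- A clique of makeUniversal H x₀ has at most one vertex in each part, plus x₀.
  makeUniversal-cliqueFree : suc p < a → ∀ x₀ → CliqueFree a (makeUniversal H x₀)
  makeUniversal-cliqueFree 1+p<a x₀ (f , f-inj , f-clique) with Finₚ.pigeonhole 1+p<a (label ∘ f)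
    where
    label : Fin i → Fin (suc p)
    label y = if ⌊ y ≟ x₀ ⌋ then zero else suc (part y)
  ... | (j , k , j<k , same-label) = clash (f j ≟ x₀) (f k ≟ x₀) same-label
    where
    j≢k : j ≢ k
    j≢k j≡k = Finₚ.<-irrefl j≡k j<k
    clash : (dj : Dec (f j ≡ x₀)) (dk : Dec (f k ≡ x₀)) →
            (if ⌊ dj ⌋ then zero else suc (part (f j))) ≡ (if ⌊ dk ⌋ then zero else suc (part (f k))) → ⊥
    clash (yes fj≡x₀) (yes fk≡x₀) _ = j≢k (f-inj (trans fj≡x₀ (sym fk≡x₀)))
    clash (yes _)     (no _)      ()
    clash (no _)      (yes _)     ()
    clash (no fj≢x₀)  (no fk≢x₀)  e with samePart-trans (in-part (f j)) (samePart-sym (subst (SamePart H (f k) ∘ K) (sym (Finₚ.suc-injective e)) (in-part (f k))))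
    ... | inj₁ fj≡fk = j≢k (f-inj fj≡fk)
    ... | inj₂ fj≁fk = true≢false (trans (sym (f-clique j k j≢k)) (trans (makeUniversal-agreeOff H x₀ (f j) (f k) fj≢x₀ fk≢x₀) fj≁fk))

  makeUniversal-degreeSum> : ∀ x₀ → suc (suc (deg H x₀)) ≤ i → m ℕ.+ m < degreeSum (makeUniversal H x₀)
  makeUniversal-degreeSum> x₀ 2+d≤i = ℕₚ.+-cancelʳ-≤ (d ℕ.+ d) (suc (m ℕ.+ m)) (degreeSum U) (begin
    suc (m ℕ.+ m) ℕ.+ (d ℕ.+ d)    ≡⟨ cong (λ s → suc s ℕ.+ (d ℕ.+ d)) (sym (Extremal.degreeSum≡ ext)) ⟩
    suc (degreeSum H) ℕ.+ (d ℕ.+ d) ≡⟨ sym (ℕₚ.+-suc (degreeSum H) (d ℕ.+ d)) ⟩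
    degreeSum H ℕ.+ suc (d ℕ.+ d)  ≤⟨ ℕₚ.+-monoʳ-≤ (degreeSum H) (ℕₚ.≤-trans (s≤s (ℕₚ.+-monoʳ-≤ d (ℕₚ.n≤1+n d))) (ℕₚ.+-mono-≤ d<dU d<dU)) ⟩
    degreeSum H ℕ.+ (dU ℕ.+ dU)    ≡⟨ sym (degreeSum-agreeOff x₀ U H (makeUniversal-agreeOff H x₀)) ⟩
    degreeSum U ℕ.+ (d ℕ.+ d)      ∎)
    where
    open ℕₚ.≤-Reasoning
    U = makeUniversal H x₀
    d = deg H x₀
    dU = deg U x₀
    d<dU : suc d ≤ dU
    d<dU = ℕₚ.+-cancelʳ-≤ 1 (suc d) dU (subst₂ _≤_ (ℕₚ.+-comm 1 (suc d)) (sym (deg-makeUniversal H x₀)) 2+d≤i)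

  few-parts⇒deg≥ : suc p < a → ∀ x → i ≤ suc (deg H x)
  few-parts⇒deg≥ 1+p<a x = ℕₚ.≮⇒≥ λ 1+d<i → ℕₚ.<⇒≱ (makeUniversal-degreeSum> x 1+d<i)
    (degreeSum≤ (makeUniversal H x) (makeUniversal-cliqueFree 1+p<a x))

  -- All parts of a regular extremal graph have size i - d, and there are exactly a - 1 of them.
  regular⇒divisible : 3 ≤ a → a ≤ i → (∀ x z → deg H x ≡ deg H z) → (a ∸ 1) ∣ i
  regular⇒divisible 3≤a a≤i regular = divides s (trans i≡p*s (trans (cong (ℕ._* s) p≡a-1) (ℕₚ.*-comm (a ∸ 1) s)))
    where
    0<i : 0 < i
    0<i = ℕₚ.<-≤-trans (s≤s z≤n) (ℕₚ.≤-trans 3≤a a≤i)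
    x₀ = Fin.fromℕ< 0<i
    d = deg H x₀
    s = i ∸ d
    d+s≡i : d ℕ.+ s ≡ i
    d+s≡i = ℕₚ.m+[n∸m]≡n (ℕₚ.<⇒≤ (deg<order H x₀))
    partSize≡s : ∀ k → sumℕ i (λ y → 𝟙 (samePart? H y (K k))) ≡ s
    partSize≡s k = sym (trans (cong (λ d′ → i ∸ d′) (sym (regular (K k) x₀)))
                               (trans (cong (_∸ deg H (K k)) (sym (deg+partSize≡order H (K k)))) (ℕₚ.m+n∸m≡n (deg H (K k)) _)))
    i≡p*s : i ≡ p ℕ.* s
    i≡p*s = trans order≡sum-partSizes (trans (sumℕ-cong p partSize≡s) (sumℕ-const p s))
    2≤s : 2 ≤ s
    2≤s with s | i≡p*s
    ... | zero         | i≡0   = ⊥-elim (ℕₚ.<-irrefl (sym (trans i≡0 (ℕₚ.*-zeroʳ p))) 0<i)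
    ... | suc zero     | i≡p   = ⊥-elim (ℕₚ.<-irrefl refl (ℕₚ.<-≤-trans p<a (ℕₚ.≤-trans a≤i (ℕₚ.≤-reflexive (trans i≡p (ℕₚ.*-identityʳ p))))))
    ... | suc (suc _)  | _     = s≤s (s≤s z≤n)
    2+d≤i : suc (suc d) ≤ i
    2+d≤i = subst₂ _≤_ (ℕₚ.+-comm d 2) d+s≡i (ℕₚ.+-monoʳ-≤ d 2≤s)
    a≤1+p : a ≤ suc p
    a≤1+p = ℕₚ.≮⇒≥ λ 1+p<a → ℕₚ.<-irrefl refl (ℕₚ.≤-trans 2+d≤i (few-parts⇒deg≥ 1+p<a x₀))
    p≡a-1 : p ≡ a ∸ 1
    p≡a-1 = cong (_∸ 1) (ℕₚ.≤-antisym p<a a≤1+p)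

  record UnbalancedTriple : Set where
    field
      u v w : Fin i
      u≢v   : u ≢ v
      u≁v   : adj H u v ≡ false
      u~w   : adj H u w ≡ true
      deg-w : deg H w ≡ suc (deg H u)

  deg<deg⇒≢ : ∀ {x z} → deg H x < deg H z → x ≢ z
  deg<deg⇒≢ dx<dz x≡z = ℕₚ.<-irrefl (cong (deg H) x≡z) dx<dz

  deg<deg⇒unbalancedTriple : ∀ x z → deg H x < deg H z → UnbalancedTriple
  deg<deg⇒unbalancedTriple x z dx<dz with adj H x z in x?z
  ... | false = ⊥-elim (ℕₚ.<-irrefl (nonadjacent⇒deg≡ x z ext (deg<deg⇒≢ dx<dz) x?z) dx<dz)
  ... | true with Finₚ.any? (λ y → ¬? (y ≟ x) ×-dec (adj H x y Bool.≟ false))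
  ...   | yes (y , y≢x , x≁y) = record { u = x ; v = y ; w = z ; u≢v = y≢x ∘ sym ; u≁v = x≁y ; u~w = x?z ; deg-w = deg-z }
    where
    deg-z : deg H z ≡ suc (deg H x)
    deg-z = ℕₚ.≤-antisym (adjacent⇒deg≤suc x z ext (deg<deg⇒≢ dx<dz) x?z) dx<dz
  ...   | no x-full = ⊥-elim (ℕₚ.<-irrefl refl (ℕₚ.<-≤-trans (deg<order H z) i≤dz))
    where
    i≤dz : i ≤ deg H z
    i≤dz = subst (_≤ deg H z) (trans (ℕₚ.+-comm 1 (deg H x)) (deg-full H x (λ y y≢x → Boolₚ.¬-not (λ x≁y → x-full (y , y≢x , x≁y))))) dx<dz

  unbalancedTriple : 3 ≤ a → a ≤ i → ¬ (a ∸ 1) ∣ i → UnbalancedTriple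
  unbalancedTriple 3≤a a≤i ∤i with Finₚ.all? (λ x → Finₚ.all? (λ z → deg H x ℕ.≟ deg H z))
  ... | yes regular = ⊥-elim (∤i (regular⇒divisible 3≤a a≤i regular))
  ... | no irregular with Finₚ.¬∀⟶∃¬ i _ (λ x → Finₚ.all? (λ z → deg H x ℕ.≟ deg H z)) irregular
  ...   | x , ¬x-regular with Finₚ.¬∀⟶∃¬ i _ (λ z → deg H x ℕ.≟ deg H z) ¬x-regular
  ...     | z , dx≢dz with ℕₚ.<-cmp (deg H x) (deg H z)
  ...       | tri< dx<dz _ _ = deg<deg⇒unbalancedTriple x z dx<dz
  ...       | tri≈ _ dx≡dz _ = ⊥-elim (dx≢dz dx≡dz)
  ...       | tri> _ _ dz<dx = deg<deg⇒unbalancedTriple z x dz<dx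

-- The exchange lemma

double≡0 : ∀ x → x + x ≡ 0ℚ → x ≡ 0ℚ
double≡0 x x+x≡0 = *-cancelʳ-≡0 x (1ℚ + 1ℚ) (λ ()) (trans (x*2≡x+x x) x+x≡0)
  where
  x*2≡x+x : ∀ x → x * (1ℚ + 1ℚ) ≡ x + x
  x*2≡x+x = solve 1 (λ x → x :* (con 1ℚ :+ con 1ℚ) := x :+ x) refl

constant-off-diagonal : ∀ {i} (f : Fin i → Fin i → ℚ) → (∀ j k → f j k ≡ f k j) →
                        (∀ x y z → x ≢ y → x ≢ z → y ≢ z → f x y ≡ f x z) →
                        ∀ x y z w → x ≢ y → z ≢ w → f x y ≡ f z w
constant-off-diagonal f f-sym rows x y z w x≢y z≢w with w ≟ x
... | yes refl with z ≟ y
...   | yes refl = f-sym x z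
...   | no z≢y   = trans (rows x y z x≢y (z≢w ∘ sym) (z≢y ∘ sym)) (f-sym x z)
constant-off-diagonal f f-sym rows x y z w x≢y z≢w | no w≢x = begin
  f x y   ≡⟨ xy≡xw ⟩
  f x w   ≡⟨ f-sym x w ⟩
  f w x   ≡⟨ wx≡wz ⟩
  f w z   ≡⟨ f-sym w z ⟩
  f z w   ∎
  where
  open ≡-Reasoning
  xy≡xw : f x y ≡ f x w
  xy≡xw with w ≟ y
  ... | yes refl = refl
  ... | no w≢y   = rows x y w x≢y (w≢x ∘ sym) (w≢y ∘ sym)
  wx≡wz : f w x ≡ f w z
  wx≡wz with z ≟ x
  ... | yes refl = refl
  ... | no z≢x   = rows w x z w≢x (z≢w ∘ sym) (z≢x ∘ sym)

record Exchange {i : ℕ} (x y z : Fin i) : Set where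
  field
    G₀ G₁ G₂ G₃ : Graph i
    agree₀₁     : AgreeOff x G₁ G₀
    agree₂₃     : AgreeOff x G₃ G₂
    G₀-xy : adj G₀ x y ≡ false
    G₁-xy : adj G₁ x y ≡ true
    G₂-xy : adj G₂ x y ≡ true
    G₃-xy : adj G₃ x y ≡ false
    G₀-xz : adj G₀ x z ≡ true
    G₁-xz : adj G₁ x z ≡ false
    G₂-xz : adj G₂ x z ≡ false
    G₃-xz : adj G₃ x z ≡ true
    G₀-G₂ : ∀ k → k ≢ x → k ≢ y → k ≢ z → adj G₀ x k ≡ adj G₂ x k
    G₁-G₃ : ∀ k → k ≢ x → k ≢ y → k ≢ z → adj G₁ x k ≡ adj G₃ x k

  graph : Fin 4 → Graph i
  graph zero                   = G₀
  graph (suc zero)             = G₁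
  graph (suc (suc zero))       = G₂
  graph (suc (suc (suc zero))) = G₃

module Weight {i : ℕ} (f : Fin i → Fin i → ℚ) (f-sym : ∀ j k → f j k ≡ f k j) where

  Ψ : Graph i → ℚ
  Ψ G = sumℚ i (λ j → sumℚ i (λ k → f j k * 𝟙ℚ (adj G j k)))

  rowDifference : Graph i → Graph i → Fin i → ℚ
  rowDifference G G′ x = sumℚ i (λ k → f x k * (𝟙ℚ (adj G x k) + - 𝟙ℚ (adj G′ x k)))

  Ψ-agreeOff : ∀ G G′ x → AgreeOff x G′ G → Ψ G + - Ψ G′ ≡ rowDifference G G′ x + rowDifference G G′ x
  Ψ-agreeOff G G′ x agree = begin
    Ψ G + - Ψ G′
      ≡⟨ sumℚ-sub i _ _ ⟩
    sumℚ i (λ j → sumℚ i (λ k → f j k * 𝟙ℚ (adj G j k)) + - sumℚ i (λ k → f j k * 𝟙ℚ (adj G′ j k)))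
      ≡⟨ sumℚ-cong i (λ j → trans (sumℚ-sub i _ _) (sumℚ-cong i (λ k → factor (f j k) _ _))) ⟩
    sumℚ i (λ j → sumℚ i (g j))
      ≡⟨ sumℚ-cong i only-row-and-column ⟩
    sumℚ i (λ j → singleℚ x R j + g j x)
      ≡⟨ sumℚ-distrib-+ i _ _ ⟩
    sumℚ i (singleℚ x R) + sumℚ i (λ j → g j x)
      ≡⟨ cong₂ _+_ (sumℚ-singleℚ i x R) (sumℚ-cong i column≡row) ⟩
    R + R ∎
    where
    open ≡-Reasoning
    R = rowDifference G G′ x
    factor : ∀ c a b → c * a + - (c * b) ≡ c * (a + - b)
    factor = solve 3 (λ c a b → c :* a :+ :- (c :* b) := c :* (a :+ :- b)) refl
    g : Fin i → Fin i → ℚ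
    g j k = f j k * (𝟙ℚ (adj G j k) + - 𝟙ℚ (adj G′ j k))
    column≡row : ∀ j → g j x ≡ f x j * (𝟙ℚ (adj G x j) + - 𝟙ℚ (adj G′ x j))
    column≡row j = cong₂ _*_ (f-sym j x) (cong₂ (λ b c → 𝟙ℚ b + - 𝟙ℚ c) (adj-sym G j x) (adj-sym G′ j x))
    g-off : ∀ j k → j ≢ x → k ≢ x → g j k ≡ 0ℚ
    g-off j k j≢x k≢x = trans (cong (λ b → f j k * (𝟙ℚ b + - 𝟙ℚ (adj G′ j k))) (sym (agree j k j≢x k≢x)))
                              (trans (cong (f j k *_) (ℚₚ.+-inverseʳ (𝟙ℚ (adj G′ j k)))) (ℚₚ.*-zeroʳ (f j k)))
    g-diag : g x x ≡ 0ℚ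
    g-diag = trans (cong₂ (λ b c → f x x * (𝟙ℚ b + - 𝟙ℚ c)) (adj-irrefl G x) (adj-irrefl G′ x)) (ℚₚ.*-zeroʳ (f x x))
    only-row-and-column : ∀ j → sumℚ i (g j) ≡ singleℚ x R j + g j x
    only-row-and-column j = by-cases (j ≟ x)
      where
      by-cases : Dec (j ≡ x) → sumℚ i (g j) ≡ singleℚ x R j + g j x
      by-cases (yes refl) = sym (trans (cong₂ _+_ (singleℚ-same x R) g-diag) (ℚₚ.+-identityʳ R))
      by-cases (no j≢x)   = trans (sumℚ-single i x (λ k k≢x → g-off j k j≢x k≢x))
                                  (sym (trans (cong (_+ g j x) (singleℚ-other R j≢x)) (ℚₚ.+-identityˡ (g j x))))

  rowDifference≡0 : ∀ G G′ x → AgreeOff x G′ G → Ψ G ≡ 0ℚ → Ψ G′ ≡ 0ℚ → rowDifference G G′ x ≡ 0ℚ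
  rowDifference≡0 G G′ x agree ΨG≡0 ΨG′≡0 = double≡0 _ (begin
    rowDifference G G′ x + rowDifference G G′ x   ≡⟨ sym (Ψ-agreeOff G G′ x agree) ⟩
    Ψ G + - Ψ G′                                  ≡⟨ cong₂ (λ p q → p + - q) ΨG≡0 ΨG′≡0 ⟩
    0ℚ + - 0ℚ                                     ≡⟨ ℚₚ.+-inverseʳ 0ℚ ⟩
    0ℚ                                            ∎)
    where open ≡-Reasoning

  module _ {x y z : Fin i} (E : Exchange x y z) (y≢z : y ≢ z) where
    open Exchange E

    exchange-row : ∀ k → f x k * ((𝟙ℚ (adj G₀ x k) + - 𝟙ℚ (adj G₁ x k)) + - (𝟙ℚ (adj G₂ x k) + - 𝟙ℚ (adj G₃ x k)))
                         ≡ singleℚ y (- (f x y + f x y)) k + singleℚ z (f x z + f x z) k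
    exchange-row k = by-cases (k ≟ x) (k ≟ y) (k ≟ z)
      where
      at-y : ∀ q → q * ((0ℚ + - 1ℚ) + - (1ℚ + - 0ℚ)) ≡ - (q + q) + 0ℚ
      at-y = solve 1 (λ q → q :* ((con 0ℚ :+ :- con 1ℚ) :+ :- (con 1ℚ :+ :- con 0ℚ)) := :- (q :+ q) :+ con 0ℚ) refl
      at-z : ∀ q → q * ((1ℚ + - 0ℚ) + - (0ℚ + - 1ℚ)) ≡ 0ℚ + (q + q)
      at-z = solve 1 (λ q → q :* ((con 1ℚ :+ :- con 0ℚ) :+ :- (con 0ℚ :+ :- con 1ℚ)) := con 0ℚ :+ (q :+ q)) refl
      at-other : ∀ q A B → q * ((A + - B) + - (A + - B)) ≡ 0ℚ + 0ℚ
      at-other = solve 3 (λ q A B → q :* ((A :+ :- B) :+ :- (A :+ :- B)) := con 0ℚ :+ con 0ℚ) refl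
      entries : ∀ {p₀ p₁ p₂ p₃ : Bool} {k} → adj G₀ x k ≡ p₀ → adj G₁ x k ≡ p₁ → adj G₂ x k ≡ p₂ → adj G₃ x k ≡ p₃ →
                (𝟙ℚ (adj G₀ x k) + - 𝟙ℚ (adj G₁ x k)) + - (𝟙ℚ (adj G₂ x k) + - 𝟙ℚ (adj G₃ x k))
                ≡ (𝟙ℚ p₀ + - 𝟙ℚ p₁) + - (𝟙ℚ p₂ + - 𝟙ℚ p₃)
      entries refl refl refl refl = refl
      by-cases : Dec (k ≡ x) → Dec (k ≡ y) → Dec (k ≡ z) →
                 f x k * ((𝟙ℚ (adj G₀ x k) + - 𝟙ℚ (adj G₁ x k)) + - (𝟙ℚ (adj G₂ x k) + - 𝟙ℚ (adj G₃ x k)))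
                 ≡ singleℚ y (- (f x y + f x y)) k + singleℚ z (f x z + f x z) k
      by-cases _ (yes refl) _ =
        trans (cong (f x k *_) (entries G₀-xy G₁-xy G₂-xy G₃-xy))
              (trans (at-y (f x k)) (sym (cong₂ _+_ (singleℚ-same k _) (singleℚ-other _ y≢z))))
      by-cases _ (no k≢y) (yes refl) =
        trans (cong (f x k *_) (entries G₀-xz G₁-xz G₂-xz G₃-xz))
              (trans (at-z (f x k)) (sym (cong₂ _+_ (singleℚ-other _ k≢y) (singleℚ-same k _))))
      by-cases (yes refl) (no k≢y) (no k≢z) =
        trans (cong (f x k *_) (entries (adj-irrefl G₀ k) (adj-irrefl G₁ k) (adj-irrefl G₂ k) (adj-irrefl G₃ k)))
              (trans (at-other (f x k) 0ℚ 0ℚ) (sym (cong₂ _+_ (singleℚ-other _ k≢y) (singleℚ-other _ k≢z))))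
      by-cases (no k≢x) (no k≢y) (no k≢z) =
        trans (cong (f x k *_) (entries (G₀-G₂ k k≢x k≢y k≢z) (G₁-G₃ k k≢x k≢y k≢z) refl refl))
              (trans (at-other (f x k) (𝟙ℚ (adj G₂ x k)) (𝟙ℚ (adj G₃ x k)))
                     (sym (cong₂ _+_ (singleℚ-other _ k≢y) (singleℚ-other _ k≢z))))

    exchange-rows : rowDifference G₀ G₁ x + - rowDifference G₂ G₃ x ≡ - (f x y + f x y) + (f x z + f x z)
    exchange-rows = begin
      rowDifference G₀ G₁ x + - rowDifference G₂ G₃ x
        ≡⟨ sumℚ-sub i _ _ ⟩
      sumℚ i (λ k → f x k * (𝟙ℚ (adj G₀ x k) + - 𝟙ℚ (adj G₁ x k)) + - (f x k * (𝟙ℚ (adj G₂ x k) + - 𝟙ℚ (adj G₃ x k))))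
        ≡⟨ sumℚ-cong i (λ k → trans (factor (f x k) _ _) (exchange-row k)) ⟩
      sumℚ i (λ k → singleℚ y (- (f x y + f x y)) k + singleℚ z (f x z + f x z) k)
        ≡⟨ sumℚ-distrib-+ i _ _ ⟩
      sumℚ i (singleℚ y (- (f x y + f x y))) + sumℚ i (singleℚ z (f x z + f x z))
        ≡⟨ cong₂ _+_ (sumℚ-singleℚ i y _) (sumℚ-singleℚ i z _) ⟩
      - (f x y + f x y) + (f x z + f x z) ∎
      where
      open ≡-Reasoning
      factor : ∀ c a b → c * a + - (c * b) ≡ c * (a + - b)
      factor = solve 3 (λ c a b → c :* a :+ :- (c :* b) := c :* (a :+ :- b)) refl

    row-exchange : (∀ r → Ψ (graph r) ≡ 0ℚ) → f x y ≡ f x z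
    row-exchange Ψ≡0 = sym (begin
      f x z                        ≡⟨ split (f x z) (f x y) ⟩
      (f x z + - f x y) + f x y    ≡⟨ cong (_+ f x y) (double≡0 (f x z + - f x y) (trans (regroup (f x y) (f x z)) rows≡0)) ⟩
      0ℚ + f x y                   ≡⟨ ℚₚ.+-identityˡ (f x y) ⟩
      f x y                        ∎)
      where
      open ≡-Reasoning
      split : ∀ b a → b ≡ (b + - a) + a
      split = solve 2 (λ b a → b := (b :+ :- a) :+ a) refl
      regroup : ∀ a b → (b + - a) + (b + - a) ≡ - (a + a) + (b + b)
      regroup = solve 2 (λ a b → (b :+ :- a) :+ (b :+ :- a) := :- (a :+ a) :+ (b :+ b)) refl
      rows≡0 : - (f x y + f x y) + (f x z + f x z) ≡ 0ℚ
      rows≡0 = begin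
        - (f x y + f x y) + (f x z + f x z)                  ≡⟨ sym exchange-rows ⟩
        rowDifference G₀ G₁ x + - rowDifference G₂ G₃ x      ≡⟨ cong₂ (λ p q → p + - q) (rowDifference≡0 G₀ G₁ x agree₀₁ (Ψ≡0 zero) (Ψ≡0 (suc zero)))
                                                                        (rowDifference≡0 G₂ G₃ x agree₂₃ (Ψ≡0 (suc (suc zero))) (Ψ≡0 (suc (suc (suc zero))))) ⟩
        0ℚ + - 0ℚ                                            ≡⟨ ℚₚ.+-inverseʳ 0ℚ ⟩
        0ℚ                                                   ∎

  Ψ-constant : ∀ γ → (∀ j k → j ≢ k → f j k ≡ γ) → ∀ G → Ψ G ≡ γ * fromℕℚ (degreeSum G)
  Ψ-constant γ f≡γ G = begin
    sumℚ i (λ j → sumℚ i (λ k → f j k * 𝟙ℚ (adj G j k)))          ≡⟨ sumℚ-cong i (λ j → sumℚ-cong i (term j)) ⟩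
    sumℚ i (λ j → sumℚ i (λ k → γ * fromℕℚ (𝟙 (adj G j k))))      ≡⟨ sumℚ-cong i (λ j → sym (*-distribˡ-sumℚ i γ _)) ⟩
    sumℚ i (λ j → γ * sumℚ i (λ k → fromℕℚ (𝟙 (adj G j k))))      ≡⟨ sym (*-distribˡ-sumℚ i γ _) ⟩
    γ * sumℚ i (λ j → sumℚ i (λ k → fromℕℚ (𝟙 (adj G j k))))      ≡⟨ cong (γ *_) (trans (sumℚ-cong i (λ j → sumℚ-fromℕℚ i _)) (sumℚ-fromℕℚ i _)) ⟩
    γ * fromℕℚ (degreeSum G)                                      ∎
    where
    open ≡-Reasoning
    term : ∀ j k → f j k * 𝟙ℚ (adj G j k) ≡ γ * fromℕℚ (𝟙 (adj G j k))
    term j k with j ≟ k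
    ... | yes refl rewrite adj-irrefl G j = trans (ℚₚ.*-zeroʳ (f j j)) (sym (ℚₚ.*-zeroʳ γ))
    ... | no j≢k   = cong₂ _*_ (f≡γ j k j≢k) (𝟙ℚ≡fromℕℚ𝟙 (adj G j k))

module _ {n : ℕ} where

  transpose-first : ∀ (x u : Fin n) → transpose x u ⟨$⟩ʳ x ≡ u
  transpose-first x u with x ≟ x
  ... | yes _  = refl
  ... | no x≢x = ⊥-elim (x≢x refl)

  transpose-other : ∀ (x u k : Fin n) → k ≢ x → k ≢ u → transpose x u ⟨$⟩ʳ k ≡ k
  transpose-other x u k k≢x k≢u with k ≟ x
  ... | yes k≡x = ⊥-elim (k≢x k≡x)
  ... | no _ with k ≟ u
  ...   | yes k≡u = ⊥-elim (k≢u k≡u)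
  ...   | no _    = refl

module ThreePoint {n : ℕ} (x y z u v w : Fin n) where

  private
    τ₁ = transpose x u
    y₁ = τ₁ ⟨$⟩ʳ y
    τ₂ = transpose y₁ v
    z₂ = τ₂ ⟨$⟩ʳ (τ₁ ⟨$⟩ʳ z)
    τ₃ = transpose z₂ w

  π : Permutation′ n
  π = τ₁ ∘ₚ τ₂ ∘ₚ τ₃

  module _ (x≢y : x ≢ y) (x≢z : x ≢ z) (y≢z : y ≢ z) (u≢v : u ≢ v) (u≢w : u ≢ w) (v≢w : v ≢ w) where

    private
      τ₁-inj = ⟨$⟩ʳ-injective τ₁
      τ₂-inj = ⟨$⟩ʳ-injective τ₂
      τ₂u≡u : τ₂ ⟨$⟩ʳ u ≡ u
      τ₂u≡u = transpose-other y₁ v u (λ u≡y₁ → x≢y (τ₁-inj (trans (transpose-first x u) u≡y₁))) u≢v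
      z₂≢u : z₂ ≢ u
      z₂≢u z₂≡u = x≢z (sym (τ₁-inj (τ₂-inj (trans z₂≡u (sym (trans (cong (τ₂ ⟨$⟩ʳ_) (transpose-first x u)) τ₂u≡u))))))
      z₂≢v : z₂ ≢ v
      z₂≢v z₂≡v = y≢z (sym (τ₁-inj (τ₂-inj (trans z₂≡v (sym (transpose-first y₁ v))))))

    π-x : π ⟨$⟩ʳ x ≡ u
    π-x = trans (cong (λ k → τ₃ ⟨$⟩ʳ (τ₂ ⟨$⟩ʳ k)) (transpose-first x u))
                (trans (cong (τ₃ ⟨$⟩ʳ_) τ₂u≡u) (transpose-other z₂ w u (z₂≢u ∘ sym) u≢w))

    π-y : π ⟨$⟩ʳ y ≡ v
    π-y = trans (cong (τ₃ ⟨$⟩ʳ_) (transpose-first y₁ v)) (transpose-other z₂ w v (z₂≢v ∘ sym) v≢w)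

    π-z : π ⟨$⟩ʳ z ≡ w
    π-z = transpose-first z₂ w

module ExchangeConstruction {i : ℕ} (a m : ℕ) (ex-bound : ∀ (H : Graph i) → CliqueFree a H → edgeCount H ≤ m)
                            {H₀ : Graph i} (ext₀ : ExtremalGraphs.Extremal a m ex-bound H₀)
                            (triple : ExtremalStructure.UnbalancedTriple a m ex-bound ext₀) where
  open ExtremalGraphs a m ex-bound
  open ExtremalStructure.UnbalancedTriple triple

  u≢w : u ≢ w
  u≢w u≡w = true≢false (trans (sym u~w) (trans (cong (adj H₀ u) (sym u≡w)) (adj-irrefl H₀ u)))

  v≢w : v ≢ w
  v≢w v≡w = true≢false (trans (sym u~w) (trans (cong (adj H₀ u) (sym v≡w)) u≁v))

  -- G₀ is H₀ relabelled so that x, y, z play the roles of u, v, w; each clone below keeps the graph extremal.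
  module ExchangeGraphs (x y z : Fin i) where

    G₀ : Graph i
    G₀ = relabel H₀ (ThreePoint.π x y z u v w)

    G₁ : Graph i
    G₁ = clone G₀ x z

    G₂′ : Graph i
    G₂′ = clone G₀ y z

    G₂ : Graph i
    G₂ = clone G₂′ z x

    G₃ : Graph i
    G₃ = clone G₂ x y

    graph : Fin 4 → Graph i
    graph zero                   = G₀
    graph (suc zero)             = G₁
    graph (suc (suc zero))       = G₂
    graph (suc (suc (suc zero))) = G₃

  module _ {x y z : Fin i} (x≢y : x ≢ y) (x≢z : x ≢ z) (y≢z : y ≢ z) where
    open ExchangeGraphs x y z
    open ThreePoint x y z u v w using (π)

    private
      πx≡u = ThreePoint.π-x x y z u v w x≢y x≢z y≢z u≢v u≢w v≢w
      πy≡v = ThreePoint.π-y x y z u v w x≢y x≢z y≢z u≢v u≢w v≢w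
      πz≡w = ThreePoint.π-z x y z u v w x≢y x≢z y≢z u≢v u≢w v≢w

    ext-G₀ : Extremal G₀
    ext-G₀ = extremal (relabel-cliqueFree H₀ π (Extremal.cliqueFree ext₀)) (trans (degreeSum-relabel H₀ π) (Extremal.degreeSum≡ ext₀))

    private
      d = deg G₀ x
      G₀-xy : adj G₀ x y ≡ false
      G₀-xy = trans (cong₂ (adj H₀) πx≡u πy≡v) u≁v
      G₀-xz : adj G₀ x z ≡ true
      G₀-xz = trans (cong₂ (adj H₀) πx≡u πz≡w) u~w
      deg₀-z : deg G₀ z ≡ suc d
      deg₀-z = trans (deg-relabel H₀ π z) (trans (cong (deg H₀) πz≡w)
                 (trans deg-w (cong suc (sym (trans (deg-relabel H₀ π x) (cong (deg H₀) πx≡u))))))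
      deg₀-y : deg G₀ y ≡ d
      deg₀-y = sym (nonadjacent⇒deg≡ x y ext-G₀ x≢y G₀-xy)
      G₀-yz : adj G₀ y z ≡ true
      G₀-yz with adj G₀ y z in y?z
      ... | true  = refl
      ... | false = ⊥-elim (ℕₚ.1+n≢n (trans (sym deg₀-z) (trans (sym (nonadjacent⇒deg≡ y z ext-G₀ y≢z y?z)) deg₀-y)))

    ext-G₁ : Extremal G₁
    ext-G₁ = clone-extremal-adjacent x z ext-G₀ x≢z G₀-xz deg₀-z

    private
      ext-G₂′ : Extremal G₂′
      ext-G₂′ = clone-extremal-adjacent y z ext-G₀ y≢z G₀-yz (trans deg₀-z (cong suc (sym deg₀-y)))
      deg₂′-x : deg G₂′ x ≡ suc d
      deg₂′-x = begin
        deg G₂′ x                          ≡⟨ sym (ℕₚ.+-identityʳ _) ⟩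
        deg G₂′ x ℕ.+ 𝟙 false              ≡⟨ cong (λ b → deg G₂′ x ℕ.+ 𝟙 b) (sym G₀-xy) ⟩
        deg G₂′ x ℕ.+ 𝟙 (adj G₀ x y)       ≡⟨ deg-clone-other G₀ y z x x≢y ⟩
        d ℕ.+ 𝟙 (adj G₀ z x)               ≡⟨ cong (λ b → d ℕ.+ 𝟙 b) (trans (adj-sym G₀ z x) G₀-xz) ⟩
        d ℕ.+ 1                            ≡⟨ ℕₚ.+-comm d 1 ⟩
        suc d                              ∎
        where open ≡-Reasoning
      deg₂′-z : deg G₂′ z ≡ d
      deg₂′-z = ℕₚ.suc-injective (begin
        suc (deg G₂′ z)                    ≡⟨ ℕₚ.+-comm 1 _ ⟩
        deg G₂′ z ℕ.+ 𝟙 true               ≡⟨ cong (λ b → deg G₂′ z ℕ.+ 𝟙 b) (sym (trans (adj-sym G₀ z y) G₀-yz)) ⟩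
        deg G₂′ z ℕ.+ 𝟙 (adj G₀ z y)       ≡⟨ deg-clone-other G₀ y z z (y≢z ∘ sym) ⟩
        deg G₀ z ℕ.+ 𝟙 (adj G₀ z z)        ≡⟨ cong (λ b → deg G₀ z ℕ.+ 𝟙 b) (adj-irrefl G₀ z) ⟩
        deg G₀ z ℕ.+ 0                     ≡⟨ trans (ℕₚ.+-identityʳ _) deg₀-z ⟩
        suc d                              ∎)
        where open ≡-Reasoning
      deg₂′-y : deg G₂′ y ≡ d
      deg₂′-y = ℕₚ.suc-injective (trans (ℕₚ.+-comm 1 _) (trans (deg-clone-self-adjacent G₀ y z G₀-yz) deg₀-z))
      G₂′-zx : adj G₂′ z x ≡ true
      G₂′-zx = trans (clone-agreeOff G₀ y z z x (y≢z ∘ sym) (x≢y)) (trans (adj-sym G₀ z x) G₀-xz)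
      G₂′-xy : adj G₂′ x y ≡ true
      G₂′-xy = trans (clone-col G₀ y z x x≢y) (trans (adj-sym G₀ z x) G₀-xz)

    ext-G₂ : Extremal G₂
    ext-G₂ = clone-extremal-adjacent z x ext-G₂′ (x≢z ∘ sym) G₂′-zx (trans deg₂′-x (cong suc (sym deg₂′-z)))

    private
      G₂-xy : adj G₂ x y ≡ true
      G₂-xy = trans (clone-agreeOff G₂′ z x x y x≢z (y≢z)) G₂′-xy
      deg₂-x : deg G₂ x ≡ d
      deg₂-x = ℕₚ.suc-injective (begin
        suc (deg G₂ x)                     ≡⟨ ℕₚ.+-comm 1 _ ⟩
        deg G₂ x ℕ.+ 𝟙 true                ≡⟨ cong (λ b → deg G₂ x ℕ.+ 𝟙 b) (sym (trans (clone-agreeOff G₀ y z x z x≢y (y≢z ∘ sym)) G₀-xz)) ⟩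
        deg G₂ x ℕ.+ 𝟙 (adj G₂′ x z)       ≡⟨ deg-clone-other G₂′ z x x x≢z ⟩
        deg G₂′ x ℕ.+ 𝟙 (adj G₂′ x x)      ≡⟨ cong (λ b → deg G₂′ x ℕ.+ 𝟙 b) (adj-irrefl G₂′ x) ⟩
        deg G₂′ x ℕ.+ 0                    ≡⟨ trans (ℕₚ.+-identityʳ _) deg₂′-x ⟩
        suc d                              ∎)
        where open ≡-Reasoning
      deg₂-y : deg G₂ y ≡ suc d
      deg₂-y = begin
        deg G₂ y                           ≡⟨ sym (ℕₚ.+-identityʳ _) ⟩
        deg G₂ y ℕ.+ 𝟙 false               ≡⟨ cong (λ b → deg G₂ y ℕ.+ 𝟙 b) (sym (trans (clone-row G₀ y z z (y≢z ∘ sym)) (adj-irrefl G₀ z))) ⟩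
        deg G₂ y ℕ.+ 𝟙 (adj G₂′ y z)       ≡⟨ deg-clone-other G₂′ z x y y≢z ⟩
        deg G₂′ y ℕ.+ 𝟙 (adj G₂′ x y)      ≡⟨ cong₂ (λ e b → e ℕ.+ 𝟙 b) deg₂′-y G₂′-xy ⟩
        d ℕ.+ 1                            ≡⟨ ℕₚ.+-comm d 1 ⟩
        suc d                              ∎
        where open ≡-Reasoning

    ext-G₃ : Extremal G₃
    ext-G₃ = clone-extremal-adjacent x y ext-G₂ x≢y G₂-xy (trans deg₂-y (cong suc (sym deg₂-x)))

    exchange : Exchange x y z
    exchange = record
      { G₀ = G₀ ; G₁ = G₁ ; G₂ = G₂ ; G₃ = G₃
      ; agree₀₁ = clone-agreeOff G₀ x z
      ; agree₂₃ = clone-agreeOff G₂ x y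
      ; G₀-xy = G₀-xy
      ; G₁-xy = trans (clone-row G₀ x z y (x≢y ∘ sym)) (trans (adj-sym G₀ z y) G₀-yz)
      ; G₂-xy = G₂-xy
      ; G₃-xy = trans (clone-row G₂ x y y (x≢y ∘ sym)) (adj-irrefl G₂ y)
      ; G₀-xz = G₀-xz
      ; G₁-xz = trans (clone-row G₀ x z z (x≢z ∘ sym)) (adj-irrefl G₀ z)
      ; G₂-xz = trans (clone-col G₂′ z x x x≢z) (adj-irrefl G₂′ x)
      ; G₃-xz = trans (clone-row G₂ x y z (x≢z ∘ sym)) (trans (clone-col G₂′ z x y y≢z) G₂′-xy)
      ; G₀-G₂ = λ k k≢x k≢y k≢z → sym (trans (clone-agreeOff G₂′ z x x k x≢z k≢z) (clone-agreeOff G₀ y z x k x≢y k≢y))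
      ; G₁-G₃ = λ k k≢x k≢y k≢z → trans (clone-row G₀ x z k k≢x)
                  (sym (trans (clone-row G₂ x y k k≢x) (trans (clone-agreeOff G₂′ z x y k y≢z k≢z) (clone-row G₀ y z k k≢y))))
      }

  exchange-graph : ∀ {x y z} (x≢y : x ≢ y) (x≢z : x ≢ z) (y≢z : y ≢ z) r →
                   Exchange.graph (exchange x≢y x≢z y≢z) r ≡ ExchangeGraphs.graph x y z r
  exchange-graph x≢y x≢z y≢z zero                   = refl
  exchange-graph x≢y x≢z y≢z (suc zero)             = refl
  exchange-graph x≢y x≢z y≢z (suc (suc zero))       = refl
  exchange-graph x≢y x≢z y≢z (suc (suc (suc zero))) = refl

  exchange-extremal : ∀ {x y z} (x≢y : x ≢ y) (x≢z : x ≢ z) (y≢z : y ≢ z) r → Extremal (ExchangeGraphs.graph x y z r)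
  exchange-extremal x≢y x≢z y≢z zero                   = ext-G₀ x≢y x≢z y≢z
  exchange-extremal x≢y x≢z y≢z (suc zero)             = ext-G₁ x≢y x≢z y≢z
  exchange-extremal x≢y x≢z y≢z (suc (suc zero))       = ext-G₂ x≢y x≢z y≢z
  exchange-extremal x≢y x≢z y≢z (suc (suc (suc zero))) = ext-G₃ x≢y x≢z y≢z

  m≢0 : m ≢ 0
  m≢0 m≡0 = ℕₚ.<-irrefl refl (begin-strict
    0                   <⟨ s≤s z≤n ⟩
    suc (deg H₀ u)      ≡⟨ sym deg-w ⟩
    deg H₀ w            ≤⟨ term≤sumℕ i (deg H₀) w ⟩
    degreeSum H₀        ≡⟨ Extremal.degreeSum≡ ext₀ ⟩
    m ℕ.+ m             ≡⟨ cong (λ n → n ℕ.+ n) m≡0 ⟩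
    0                   ∎)
    where open ℕₚ.≤-Reasoning

  -- Exchanges make f constant off the diagonal, and then Ψ H₀ = 2 m f u v.
  weights-vanish : ∀ (f : Fin i → Fin i → ℚ) (f-sym : ∀ j k → f j k ≡ f k j) → let open Weight f f-sym in
                   (∀ {x y z} (x≢y : x ≢ y) (x≢z : x ≢ z) (y≢z : y ≢ z) r → Ψ (Exchange.graph (exchange x≢y x≢z y≢z) r) ≡ 0ℚ) →
                   Ψ H₀ ≡ 0ℚ → ∀ j k → j ≢ k → f j k ≡ 0ℚ
  weights-vanish f f-sym Ψ-exchange≡0 ΨH₀≡0 j k j≢k = trans (f≡γ j k j≢k) γ≡0
    where
    open Weight f f-sym
    γ = f u v
    f≡γ : ∀ j k → j ≢ k → f j k ≡ γ
    f≡γ j k j≢k = constant-off-diagonal f f-sym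
      (λ x y z x≢y x≢z y≢z → row-exchange (exchange x≢y x≢z y≢z) y≢z (Ψ-exchange≡0 x≢y x≢z y≢z)) j k u v j≢k u≢v
    γ≡0 : γ ≡ 0ℚ
    γ≡0 = *-cancelʳ-≡0 γ (fromℕℚ (m ℕ.+ m)) (fromℕℚ≢0 (m ℕ.+ m) (m≢0 ∘ ℕₚ.m+n≡0⇒m≡0 m))
      (trans (sym (trans (Ψ-constant γ f≡γ H₀) (cong (λ s → γ * fromℕℚ s) (Extremal.degreeSum≡ ext₀)))) ΨH₀≡0)

-- Single edges and edge coordinates

lookup-injective : ∀ {A : Set} {xs : List A} → Unique xs → Injective _≡_ _≡_ (lookup xs)
lookup-injective {xs = x ∷ xs} (x∉xs ∷ _)  {zero}  {zero}  _ = refl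
lookup-injective {xs = x ∷ xs} (x∉xs ∷ _)  {zero}  {suc j} e = ⊥-elim (All.lookup x∉xs (∈-lookup j) e)
lookup-injective {xs = x ∷ xs} (x∉xs ∷ _)  {suc j} {zero}  e = ⊥-elim (All.lookup x∉xs (∈-lookup j) (sym e))
lookup-injective {xs = x ∷ xs} (_ ∷ unique) {suc j} {suc k} e = cong suc (lookup-injective unique e)

module _ {n : ℕ} where

  singleEdge : Fin n → Fin n → EdgeRel n
  singleEdge x y u v = (⌊ u ≟ x ⌋ ∧ ⌊ v ≟ y ⌋) ∨ (⌊ u ≟ y ⌋ ∧ ⌊ v ≟ x ⌋)

  singleEdge-true : ∀ x y u v → singleEdge x y u v ≡ true → (u ≡ x × v ≡ y) ⊎ (u ≡ y × v ≡ x)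
  singleEdge-true x y u v eq with u ≟ x | v ≟ y | u ≟ y | v ≟ x
  ... | yes u≡x | yes v≡y | _       | _       = inj₁ (u≡x , v≡y)
  ... | _       | _       | yes u≡y | yes v≡x = inj₂ (u≡y , v≡x)
  ... | no _    | _       | no _    | _       = ⊥-elim (true≢false (sym eq))
  ... | no _    | _       | yes _   | no _    = ⊥-elim (true≢false (sym eq))
  ... | yes _   | no _    | no _    | _       = ⊥-elim (true≢false (sym eq))
  ... | yes _   | no _    | yes _   | no _    = ⊥-elim (true≢false (sym eq))

  singleEdge-sym : ∀ x y u v → singleEdge x y u v ≡ singleEdge x y v u
  singleEdge-sym x y u v = swap ⌊ u ≟ x ⌋ ⌊ v ≟ y ⌋ ⌊ u ≟ y ⌋ ⌊ v ≟ x ⌋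
    where
    swap : ∀ p q r s → (p ∧ q) ∨ (r ∧ s) ≡ (s ∧ r) ∨ (q ∧ p)
    swap p q r s = trans (Boolₚ.∨-comm (p ∧ q) (r ∧ s)) (cong₂ _∨_ (Boolₚ.∧-comm r s) (Boolₚ.∧-comm p q))

  singleEdge-ends : ∀ x y → singleEdge x y x y ≡ true
  singleEdge-ends x y with x ≟ x | y ≟ y
  ... | yes _  | yes _  = refl
  ... | no x≢x | _      = ⊥-elim (x≢x refl)
  ... | yes _  | no y≢y = ⊥-elim (y≢y refl)

  singleEdge-false : ∀ x y u v → ¬ ((u ≡ x × v ≡ y) ⊎ (u ≡ y × v ≡ x)) → singleEdge x y u v ≡ false
  singleEdge-false x y u v ¬ends with singleEdge x y u v in eq
  ... | true  = ⊥-elim (¬ends (singleEdge-true x y u v eq))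
  ... | false = refl

  singleEdge-cliqueFree : ∀ {a} → 3 ≤ a → ∀ x y (F : EdgeRel n) → (∀ u v → F u v ≡ true → singleEdge x y u v ≡ true) →
                          ¬ HasClique a F
  singleEdge-cliqueFree {suc zero}       (s≤s ())
  singleEdge-cliqueFree {suc (suc zero)} (s≤s (s≤s ()))
  singleEdge-cliqueFree {suc (suc (suc a))} _ x y F F⊆xy (f , f-inj , f-clique)
    with singleEdge-true x y (f zero) (f (suc zero)) (F⊆xy _ _ (f-clique zero (suc zero) λ ()))
       | singleEdge-true x y (f zero) (f (suc (suc zero))) (F⊆xy _ _ (f-clique zero (suc (suc zero)) λ ()))
  ... | inj₁ (_ , f₁≡y) | inj₁ (_ , f₂≡y) with f-inj (trans f₁≡y (sym f₂≡y))
  ...   | ()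
  singleEdge-cliqueFree _ x y F F⊆xy (f , f-inj , f-clique) | inj₂ (_ , f₁≡x) | inj₂ (_ , f₂≡x) with f-inj (trans f₁≡x (sym f₂≡x))
  ...   | ()
  singleEdge-cliqueFree _ x y F F⊆xy (f , f-inj , f-clique) | inj₁ (_ , f₁≡y) | inj₂ (f₀≡y , _) with f-inj (trans f₀≡y (sym f₁≡y))
  ...   | ()
  singleEdge-cliqueFree _ x y F F⊆xy (f , f-inj , f-clique) | inj₂ (_ , f₁≡x) | inj₁ (f₀≡x , _) with f-inj (trans f₀≡x (sym f₁≡x))
  ...   | ()

  singleEdge⊆ : ∀ (G : Graph n) {x y} → adj G x y ≡ true → ∀ u v → singleEdge x y u v ≡ true → adj G u v ≡ true
  singleEdge⊆ G {x} {y} x~y u v uv with singleEdge-true x y u v uv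
  ... | inj₁ (refl , refl) = x~y
  ... | inj₂ (refl , refl) = trans (adj-sym G y x) x~y

  sumℚ-singleEdge : ∀ {x y} → x ≢ y → (g : Fin n → Fin n → ℚ) →
                    sumℚ n (λ u → sumℚ n (λ v → χ (singleEdge x y) u v * g u v)) ≡ g x y + g y x
  sumℚ-singleEdge {x} {y} x≢y g = begin
    sumℚ n (λ u → sumℚ n (λ v → χ (singleEdge x y) u v * g u v))  ≡⟨ sumℚ-cong n row ⟩
    sumℚ n (λ u → singleℚ x (g x y) u + singleℚ y (g y x) u)      ≡⟨ sumℚ-distrib-+ n _ _ ⟩
    sumℚ n (singleℚ x (g x y)) + sumℚ n (singleℚ y (g y x))       ≡⟨ cong₂ _+_ (sumℚ-singleℚ n x _) (sumℚ-singleℚ n y _) ⟩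
    g x y + g y x                                                 ∎
    where
    open ≡-Reasoning
    term≡0 : ∀ u v → singleEdge x y u v ≡ false → χ (singleEdge x y) u v * g u v ≡ 0ℚ
    term≡0 u v eq = trans (cong (λ b → 𝟙ℚ b * g u v) eq) (ℚₚ.*-zeroˡ (g u v))
    term≡g : ∀ u v → singleEdge x y u v ≡ true → χ (singleEdge x y) u v * g u v ≡ g u v
    term≡g u v eq = trans (cong (λ b → 𝟙ℚ b * g u v) eq) (ℚₚ.*-identityˡ (g u v))
    y-x : singleEdge x y y x ≡ true
    y-x = trans (singleEdge-sym x y y x) (singleEdge-ends x y)
    row : ∀ u → sumℚ n (λ v → χ (singleEdge x y) u v * g u v) ≡ singleℚ x (g x y) u + singleℚ y (g y x) u
    row u = by-cases (u ≟ x) (u ≟ y)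
      where
      by-cases : Dec (u ≡ x) → Dec (u ≡ y) →
                 sumℚ n (λ v → χ (singleEdge x y) u v * g u v) ≡ singleℚ x (g x y) u + singleℚ y (g y x) u
      by-cases (yes refl) _ = begin
        sumℚ n (λ v → χ (singleEdge x y) x v * g x v)   ≡⟨ sumℚ-single n y (λ v v≢y → term≡0 x v (singleEdge-false x y x v
                                                              λ { (inj₁ (_ , v≡y)) → v≢y v≡y ; (inj₂ (x≡y , _)) → x≢y x≡y })) ⟩
        χ (singleEdge x y) x y * g x y                  ≡⟨ term≡g x y (singleEdge-ends x y) ⟩
        g x y                                           ≡⟨ sym (ℚₚ.+-identityʳ (g x y)) ⟩
        g x y + 0ℚ                                      ≡⟨ sym (cong₂ _+_ (singleℚ-same x (g x y)) (singleℚ-other (g y x) x≢y)) ⟩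
        singleℚ x (g x y) x + singleℚ y (g y x) x       ∎
      by-cases (no u≢x) (yes refl) = begin
        sumℚ n (λ v → χ (singleEdge x y) y v * g y v)   ≡⟨ sumℚ-single n x (λ v v≢x → term≡0 y v (singleEdge-false x y y v
                                                              λ { (inj₁ (y≡x , _)) → x≢y (sym y≡x) ; (inj₂ (_ , v≡x)) → v≢x v≡x })) ⟩
        χ (singleEdge x y) y x * g y x                  ≡⟨ term≡g y x y-x ⟩
        g y x                                           ≡⟨ sym (ℚₚ.+-identityˡ (g y x)) ⟩
        0ℚ + g y x                                      ≡⟨ sym (cong₂ _+_ (singleℚ-other (g x y) u≢x) (singleℚ-same y (g y x))) ⟩
        singleℚ x (g x y) y + singleℚ y (g y x) y       ∎
      by-cases (no u≢x) (no u≢y) = trans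
        (sumℚ-zero n (λ v → term≡0 u v (singleEdge-false x y u v λ { (inj₁ (u≡x , _)) → u≢x u≡x ; (inj₂ (u≡y , _)) → u≢y u≡y })))
        (sym (trans (cong₂ _+_ (singleℚ-other (g x y) u≢x) (singleℚ-other (g y x) u≢y)) (ℚₚ.+-identityˡ 0ℚ)))

χ-sym : ∀ {n} (F : EdgeRel n) → (∀ u v → F u v ≡ F v u) → ∀ u v → χ F u v ≡ χ F v u
χ-sym F F-sym u v = cong 𝟙ℚ (F-sym u v)

-- Coordinates of ℚ^{E(G)}: the edges of G listed as pairs (e₁ t, e₂ t) with e₁ t < e₂ t.
module EdgeCoordinates {n : ℕ} (G : Graph n) where

  IsEdge : Fin n × Fin n → Set
  IsEdge (u , v) = toℕ u < toℕ v × adj G u v ≡ true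

  isEdge? : ∀ uv → Dec (IsEdge uv)
  isEdge? (u , v) = (toℕ u ℕ.<? toℕ v) ×-dec (adj G u v Bool.≟ true)

  edgeList : List (Fin n × Fin n)
  edgeList = filter isEdge? (cartesianProduct (allFin n) (allFin n))

  k : ℕ
  k = length edgeList

  e₁ e₂ : Fin k → Fin n
  e₁ t = proj₁ (lookup edgeList t)
  e₂ t = proj₂ (lookup edgeList t)

  isEdge-e : ∀ t → IsEdge (e₁ t , e₂ t)
  isEdge-e t = proj₂ (∈-filter⁻ isEdge? {xs = cartesianProduct (allFin n) (allFin n)} (∈-lookup {xs = edgeList} t))

  e₁<e₂ : ∀ t → toℕ (e₁ t) < toℕ (e₂ t)
  e₁<e₂ t = proj₁ (isEdge-e t)

  e₁≢e₂ : ∀ t → e₁ t ≢ e₂ t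
  e₁≢e₂ t e₁≡e₂ = ℕₚ.<-irrefl (cong toℕ e₁≡e₂) (e₁<e₂ t)

  e-adj : ∀ t → adj G (e₁ t) (e₂ t) ≡ true
  e-adj t = proj₂ (isEdge-e t)

  e-injective : ∀ {t t′} → e₁ t ≡ e₁ t′ → e₂ t ≡ e₂ t′ → t ≡ t′
  e-injective e₁≡ e₂≡ = lookup-injective (filter⁺ isEdge? (cartesianProduct⁺ (allFin⁺ n) (allFin⁺ n))) (cong₂ _,_ e₁≡ e₂≡)

  Joins : Fin k → Fin n → Fin n → Set
  Joins t u v = (e₁ t ≡ u × e₂ t ≡ v) ⊎ (e₁ t ≡ v × e₂ t ≡ u)

  edge-listed : ∀ {u v} → IsEdge (u , v) → Σ[ t ∈ Fin k ] lookup edgeList t ≡ (u , v)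
  edge-listed {u} {v} uv-edge = Any.index uv∈ , sym (lookup-index uv∈)
    where uv∈ = ∈-filter⁺ isEdge? (∈-cartesianProduct⁺ (∈-allFin u) (∈-allFin v)) uv-edge

  edge-joining : ∀ u v → adj G u v ≡ true → Σ[ t ∈ Fin k ] Joins t u v
  edge-joining u v u~v with Finₚ.<-cmp u v
  ... | tri< u<v _ _  = let (t , eq) = edge-listed (u<v , u~v) in t , inj₁ (cong proj₁ eq , cong proj₂ eq)
  ... | tri≈ _ refl _ = ⊥-elim (true≢false (trans (sym u~v) (adj-irrefl G u)))
  ... | tri> _ _ v<u  = let (t , eq) = edge-listed (v<u , trans (adj-sym G v u) u~v) in t , inj₂ (cong proj₁ eq , cong proj₂ eq)

  singleEdge-other : ∀ t t′ → t′ ≢ t → singleEdge (e₁ t) (e₂ t) (e₁ t′) (e₂ t′) ≡ false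
  singleEdge-other t t′ t′≢t = singleEdge-false _ _ _ _ λ
    { (inj₁ (e₁≡ , e₂≡)) → t′≢t (e-injective e₁≡ e₂≡)
    ; (inj₂ (e₁≡ , e₂≡)) → ℕₚ.<-asym (e₁<e₂ t) (subst₂ (λ a b → toℕ a < toℕ b) e₁≡ e₂≡ (e₁<e₂ t′)) }

  χ-outside : ∀ F → EdgeSubset G F → ∀ u v → adj G u v ≡ false → χ F u v ≡ 0ℚ
  χ-outside F (_ , F⊆G) u v u≁v with F u v in F-uv
  ... | true  = ⊥-elim (true≢false (trans (sym (F⊆G u v F-uv)) u≁v))
  ... | false = refl

  combination-vanishes-at : ∀ {N} (Fs : Fin N → EdgeRel n) → (∀ j → EdgeSubset G (Fs j)) → (λ′ : Fin N → ℚ) → ∀ u v →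
                            (∀ t → Joins t u v → sumℚ N (λ j → λ′ j * χ (Fs j) (e₁ t) (e₂ t)) ≡ 0ℚ) →
                            sumℚ N (λ j → λ′ j * χ (Fs j) u v) ≡ 0ℚ
  combination-vanishes-at {N} Fs Fs⊆G λ′ u v on-edge with adj G u v in u?v
  ... | false = sumℚ-zero N (λ j → trans (cong (λ′ j *_) (χ-outside (Fs j) (Fs⊆G j) u v u?v)) (ℚₚ.*-zeroʳ (λ′ j)))
  ... | true with edge-joining u v u?v
  ...   | t , joins@(inj₁ (refl , refl)) = on-edge t joins
  ...   | t , joins@(inj₂ (refl , refl)) =
    trans (sumℚ-cong N (λ j → cong (λ′ j *_) (χ-sym (Fs j) (proj₁ (Fs⊆G j)) (e₂ t) (e₁ t)))) (on-edge t joins)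

  combination-vanishes : ∀ {N} (Fs : Fin N → EdgeRel n) → (∀ j → EdgeSubset G (Fs j)) → (λ′ : Fin N → ℚ) →
                         (∀ t → sumℚ N (λ j → λ′ j * χ (Fs j) (e₁ t) (e₂ t)) ≡ 0ℚ) →
                         ∀ u v → sumℚ N (λ j → λ′ j * χ (Fs j) u v) ≡ 0ℚ
  combination-vanishes Fs Fs⊆G λ′ on-edges u v = combination-vanishes-at Fs Fs⊆G λ′ u v (λ t _ → on-edges t)

  module Coefficients (c : Fin k → ℚ) where

    Φ : EdgeRel n → ℚ
    Φ F = sumℚ k (λ t → c t * χ F (e₁ t) (e₂ t))

    C : Fin n → Fin n → ℚ
    C u v = sumℚ k (λ t → c t * χ (singleEdge (e₁ t) (e₂ t)) u v)

    C-sym : ∀ u v → C u v ≡ C v u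
    C-sym u v = sumℚ-cong k (λ t → cong (c t *_) (χ-sym _ (singleEdge-sym (e₁ t) (e₂ t)) u v))

    C-edge : ∀ t → C (e₁ t) (e₂ t) ≡ c t
    C-edge t = begin
      C (e₁ t) (e₂ t)                                     ≡⟨ sumℚ-single k t (λ t′ t′≢t → trans (cong (λ b → c t′ * 𝟙ℚ b) (singleEdge-other t′ t (t′≢t ∘ sym))) (ℚₚ.*-zeroʳ (c t′))) ⟩
      c t * χ (singleEdge (e₁ t) (e₂ t)) (e₁ t) (e₂ t)    ≡⟨ cong (λ b → c t * 𝟙ℚ b) (singleEdge-ends (e₁ t) (e₂ t)) ⟩
      c t * 1ℚ                                            ≡⟨ ℚₚ.*-identityʳ (c t) ⟩
      c t                                                 ∎
      where open ≡-Reasoning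

    Φ-double : ∀ F → (∀ u v → F u v ≡ F v u) → sumℚ n (λ u → sumℚ n (λ v → C u v * χ F u v)) ≡ Φ F + Φ F
    Φ-double F F-sym = begin
      sumℚ n (λ u → sumℚ n (λ v → C u v * χ F u v))
        ≡⟨ sumℚ-cong n (λ u → sumℚ-cong n (λ v → trans (*-distribʳ-sumℚ k (χ F u v) _)
                                                        (sumℚ-cong k (λ t → ℚₚ.*-assoc (c t) _ (χ F u v))))) ⟩
      sumℚ n (λ u → sumℚ n (λ v → sumℚ k (λ t → c t * (s t u v * χ F u v))))
        ≡⟨ trans (sumℚ-cong n (λ u → sumℚ-comm n k _)) (sumℚ-comm n k _) ⟩
      sumℚ k (λ t → sumℚ n (λ u → sumℚ n (λ v → c t * (s t u v * χ F u v))))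
        ≡⟨ sumℚ-cong k (λ t → trans (sumℚ-cong n (λ u → sym (*-distribˡ-sumℚ n (c t) _))) (sym (*-distribˡ-sumℚ n (c t) _))) ⟩
      sumℚ k (λ t → c t * sumℚ n (λ u → sumℚ n (λ v → s t u v * χ F u v)))
        ≡⟨ sumℚ-cong k (λ t → cong (c t *_) (trans (sumℚ-singleEdge (e₁≢e₂ t) (χ F))
                                                    (cong (χ F (e₁ t) (e₂ t) +_) (χ-sym F F-sym (e₂ t) (e₁ t))))) ⟩
      sumℚ k (λ t → c t * (χ F (e₁ t) (e₂ t) + χ F (e₁ t) (e₂ t)))
        ≡⟨ sumℚ-cong k (λ t → ℚₚ.*-distribˡ-+ (c t) _ _) ⟩
      sumℚ k (λ t → c t * χ F (e₁ t) (e₂ t) + c t * χ F (e₁ t) (e₂ t))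
        ≡⟨ sumℚ-distrib-+ k _ _ ⟩
      Φ F + Φ F ∎
      where
      open ≡-Reasoning
      s : Fin k → Fin n → Fin n → ℚ
      s t = χ (singleEdge (e₁ t) (e₂ t))

third-element : ∀ {a} → 3 ≤ a → (j k : Fin a) → ∃[ l ] l ≢ j × l ≢ k
third-element {suc zero}          (s≤s ())       _ _
third-element {suc (suc zero)}    (s≤s (s≤s ())) _ _
third-element {suc (suc (suc _))} _ (suc _)       (suc _)       = zero , (λ ()) , (λ ())
third-element {suc (suc (suc _))} _ zero          zero          = suc zero , (λ ()) , (λ ())
third-element {suc (suc (suc _))} _ zero          (suc zero)    = suc (suc zero) , (λ ()) , (λ ())
third-element {suc (suc (suc _))} _ zero          (suc (suc _)) = suc zero , (λ ()) , (λ ())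
third-element {suc (suc (suc _))} _ (suc zero)    zero          = suc (suc zero) , (λ ()) , (λ ())
third-element {suc (suc (suc _))} _ (suc (suc _)) zero          = suc zero , (λ ()) , (λ ())

-- Lifting graphs on the clique

module CliqueLift {n i : ℕ} (q : Fin i → Fin n) (q-inj : Injective _≡_ _≡_ q) where

  InClique : Fin n → Set
  InClique u = ∃[ j ] q j ≡ u

  inClique? : ∀ u → Dec (InClique u)
  inClique? u = Finₚ.any? (λ j → q j ≟ u)

  sumℚ-reindex : (g : Fin n → ℚ) → (∀ u → ¬ InClique u → g u ≡ 0ℚ) → sumℚ n g ≡ sumℚ i (g ∘ q)
  sumℚ-reindex g g-outside = begin
    sumℚ n g                                        ≡⟨ sumℚ-cong n spread ⟩
    sumℚ n (λ u → sumℚ i (λ j → singleℚ (q j) (g u) u)) ≡⟨ sumℚ-comm n i _ ⟩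
    sumℚ i (λ j → sumℚ n (λ u → singleℚ (q j) (g u) u)) ≡⟨ sumℚ-cong i (λ j → trans (sumℚ-single n (q j) (λ u → singleℚ-other (g u))) (singleℚ-same (q j) _)) ⟩
    sumℚ i (g ∘ q)                                  ∎
    where
    open ≡-Reasoning
    spread : ∀ u → g u ≡ sumℚ i (λ j → singleℚ (q j) (g u) u)
    spread u with inClique? u
    ... | yes (j₀ , refl) = sym (trans (sumℚ-single i j₀ (λ j j≢j₀ → singleℚ-other (g (q j₀)) (λ e → j≢j₀ (sym (q-inj e)))))
                                       (singleℚ-same (q j₀) (g (q j₀))))
    ... | no u∉q = trans (g-outside u u∉q) (sym (sumℚ-zero i (λ j → singleℚ-other (g u) (λ u≡qj → u∉q (j , sym u≡qj)))))

  lift : Graph i → EdgeRel n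
  lift H u v with inClique? u | inClique? v
  ... | yes (j , _) | yes (k , _) = adj H j k
  ... | _           | _           = false

  lift-q : ∀ H j k → lift H (q j) (q k) ≡ adj H j k
  lift-q H j k with inClique? (q j) | inClique? (q k)
  ... | yes (j′ , qj′≡qj) | yes (k′ , qk′≡qk) = cong₂ (adj H) (q-inj qj′≡qj) (q-inj qk′≡qk)
  ... | no j∉q            | _                 = ⊥-elim (j∉q (j , refl))
  ... | yes _             | no k∉q            = ⊥-elim (k∉q (k , refl))

  lift-true : ∀ H u v → lift H u v ≡ true → Σ[ j ∈ Fin i ] Σ[ k ∈ Fin i ] q j ≡ u × q k ≡ v × adj H j k ≡ true
  lift-true H u v eq with inClique? u | inClique? v
  ... | yes (j , qj≡u) | yes (k , qk≡v) = j , k , qj≡u , qk≡v , eq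

  lift-outside : ∀ H u v → ¬ (InClique u × InClique v) → lift H u v ≡ false
  lift-outside H u v outside with lift H u v in eq
  ... | false = refl
  ... | true  = let (j , k , qj≡u , qk≡v , _) = lift-true H u v eq in ⊥-elim (outside ((j , qj≡u) , (k , qk≡v)))

  lift-flip : ∀ H u v → lift H u v ≡ true → lift H v u ≡ true
  lift-flip H u v eq with lift-true H u v eq
  ... | j , k , refl , refl , j~k = trans (lift-q H k j) (trans (adj-sym H k j) j~k)

  lift-sym : ∀ H u v → lift H u v ≡ lift H v u
  lift-sym H u v with lift H u v in uv | lift H v u in vu
  ... | true  | true  = refl
  ... | false | false = refl
  ... | true  | false = ⊥-elim (true≢false (trans (sym (lift-flip H u v uv)) vu))
  ... | false | true  = ⊥-elim (true≢false (trans (sym (lift-flip H v u vu)) uv))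

  cliqueLHS-χ : ∀ (F : EdgeRel n) (H : Graph i) → (∀ j k → F (q j) (q k) ≡ adj H j k) →
                cliqueLHS q (χ F) ≡ fromℕℚ (edgeCount H)
  cliqueLHS-χ F H F≡H = trans (sumℚ-cong i (λ j → trans (sumℚ-cong i (term j)) (sumℚ-fromℕℚ i _))) (sumℚ-fromℕℚ i _)
    where
    term : ∀ j k → upperℚ (λ j k → χ F (q j) (q k)) j k ≡ fromℕℚ (if (toℕ j <ᵇ toℕ k) ∧ adj H j k then 1 else 0)
    term j k rewrite F≡H j k with toℕ j <ᵇ toℕ k | adj H j k
    ... | true  | true  = refl
    ... | true  | false = refl
    ... | false | _     = refl

  lift-cliqueFree : ∀ {a} H → 2 ≤ a → CliqueFree a H → ¬ HasClique a (lift H)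
  lift-cliqueFree {suc zero}    H (s≤s ())
  lift-cliqueFree {suc (suc a)} H _ free (f , f-inj , f-clique) = free (g , g-inj , g-clique)
    where
    partner : Fin (suc (suc a)) → Fin (suc (suc a))
    partner zero    = suc zero
    partner (suc _) = zero
    partner≢ : ∀ j → j ≢ partner j
    partner≢ zero    ()
    partner≢ (suc j) ()
    preimage : ∀ j → Σ[ j′ ∈ Fin i ] q j′ ≡ f j
    preimage j = let (j′ , _ , qj′≡fj , _) = lift-true H (f j) (f (partner j)) (f-clique j (partner j) (partner≢ j)) in j′ , qj′≡fj
    g : Fin (suc (suc a)) → Fin i
    g j = proj₁ (preimage j)
    g-inj : Injective _≡_ _≡_ g
    g-inj {j} {k} gj≡gk = f-inj (trans (sym (proj₂ (preimage j))) (trans (cong q gj≡gk) (proj₂ (preimage k))))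
    g-clique : ∀ j k → j ≢ k → adj H (g j) (g k) ≡ true
    g-clique j k j≢k = trans (sym (lift-q H (g j) (g k))) (trans (cong₂ (lift H) (proj₂ (preimage j)) (proj₂ (preimage k))) (f-clique j k j≢k))

  withEdge : Graph i → Fin n → Fin n → EdgeRel n
  withEdge H x y u v = lift H u v ∨ singleEdge x y u v

  module _ {x y : Fin n} (outside : ¬ (InClique x × InClique y)) where

    withEdge-q : ∀ H j k → withEdge H x y (q j) (q k) ≡ adj H j k
    withEdge-q H j k = trans (cong₂ _∨_ (lift-q H j k) (singleEdge-false x y (q j) (q k) not-xy)) (Boolₚ.∨-identityʳ (adj H j k))
      where
      not-xy : ¬ ((q j ≡ x × q k ≡ y) ⊎ (q j ≡ y × q k ≡ x))
      not-xy (inj₁ (qj≡x , qk≡y)) = outside ((j , qj≡x) , (k , qk≡y))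
      not-xy (inj₂ (qj≡y , qk≡x)) = outside ((k , qk≡x) , (j , qj≡y))

    -- A third vertex of a clique through the edge xy would make both x and y clique vertices.
    withEdge-cliqueFree : ∀ {a} H → 3 ≤ a → CliqueFree a H → ¬ HasClique a (withEdge H x y)
    withEdge-cliqueFree {a} H 3≤a free (f , f-inj , f-clique) =
      lift-cliqueFree H (ℕₚ.≤-trans (s≤s (s≤s z≤n)) 3≤a) free (f , f-inj , lift-clique)
      where
      ∨-true : ∀ {b c} → b ∨ c ≡ true → (b ≡ true) ⊎ (c ≡ true)
      ∨-true {true}  _  = inj₁ refl
      ∨-true {false} eq = inj₂ eq
      endpoint-inClique : ∀ l j k → l ≢ j → l ≢ k → singleEdge x y (f j) (f k) ≡ true → InClique (f j)
      endpoint-inClique l j k l≢j l≢k jk-edge with ∨-true {lift H (f l) (f j)} (f-clique l j l≢j)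
      ... | inj₁ lj-lifted = let (_ , j′ , _ , qj′≡fj , _) = lift-true H (f l) (f j) lj-lifted in j′ , qj′≡fj
      ... | inj₂ lj-edge with singleEdge-true x y (f j) (f k) jk-edge | singleEdge-true x y (f l) (f j) lj-edge
      ...   | inj₁ (fj≡x , _) | inj₁ (fl≡x , _) = ⊥-elim (l≢j (f-inj (trans fl≡x (sym fj≡x))))
      ...   | inj₁ (_ , fk≡y) | inj₂ (fl≡y , _) = ⊥-elim (l≢k (f-inj (trans fl≡y (sym fk≡y))))
      ...   | inj₂ (_ , fk≡x) | inj₁ (fl≡x , _) = ⊥-elim (l≢k (f-inj (trans fl≡x (sym fk≡x))))
      ...   | inj₂ (fj≡y , _) | inj₂ (fl≡y , _) = ⊥-elim (l≢j (f-inj (trans fl≡y (sym fj≡y))))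
      lift-clique : ∀ j k → j ≢ k → lift H (f j) (f k) ≡ true
      lift-clique j k j≢k with lift H (f j) (f k) in jk-lifted | ∨-true {lift H (f j) (f k)} (f-clique j k j≢k)
      ... | true  | _             = refl
      ... | false | inj₁ ()
      ... | false | inj₂ jk-edge  = ⊥-elim (outside (both (singleEdge-true x y (f j) (f k) jk-edge)))
        where
        l = proj₁ (third-element 3≤a j k)
        l≢j = proj₁ (proj₂ (third-element 3≤a j k))
        l≢k = proj₂ (proj₂ (third-element 3≤a j k))
        fj∈ : InClique (f j)
        fj∈ = endpoint-inClique l j k l≢j l≢k jk-edge
        fk∈ : InClique (f k)
        fk∈ = endpoint-inClique l k j l≢k l≢j (trans (singleEdge-sym x y (f k) (f j)) jk-edge)
        both : (f j ≡ x × f k ≡ y) ⊎ (f j ≡ y × f k ≡ x) → InClique x × InClique y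
        both (inj₁ (refl , refl)) = fj∈ , fk∈
        both (inj₂ (refl , refl)) = fk∈ , fj∈

  module _ (G : Graph n) (q-clique : ∀ j k → j ≢ k → adj G (q j) (q k) ≡ true) where

    lift-edgeSubset : ∀ H → EdgeSubset G (lift H)
    lift-edgeSubset H = lift-sym H , lift⊆G
      where
      lift⊆G : ∀ u v → lift H u v ≡ true → adj G u v ≡ true
      lift⊆G u v eq with lift-true H u v eq
      ... | j , k , refl , refl , j~k = q-clique j k λ { refl → true≢false (trans (sym j~k) (adj-irrefl H j)) }

    withEdge-edgeSubset : ∀ H {x y} → adj G x y ≡ true → EdgeSubset G (withEdge H x y)
    withEdge-edgeSubset H {x} {y} x~y = (λ u v → cong₂ _∨_ (lift-sym H u v) (singleEdge-sym x y u v)) , withEdge⊆G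
      where
      withEdge⊆G : ∀ u v → withEdge H x y u v ≡ true → adj G u v ≡ true
      withEdge⊆G u v eq with lift H u v in uv-lifted
      ... | true  = proj₂ (lift-edgeSubset H) u v uv-lifted
      ... | false = singleEdge⊆ G x~y u v eq

    module _ (c : Fin (EdgeCoordinates.k G) → ℚ) where
      open EdgeCoordinates G
      open Coefficients c

      f : Fin i → Fin i → ℚ
      f j j′ = C (q j) (q j′)

      f-sym : ∀ j j′ → f j j′ ≡ f j′ j
      f-sym j j′ = C-sym (q j) (q j′)

      Ψ-lift : ∀ H → Weight.Ψ f f-sym H ≡ Φ (lift H) + Φ (lift H)
      Ψ-lift H = begin
        sumℚ i (λ j → sumℚ i (λ j′ → C (q j) (q j′) * 𝟙ℚ (adj H j j′)))
          ≡⟨ sumℚ-cong i (λ j → sumℚ-cong i (λ j′ → cong (λ b → C (q j) (q j′) * 𝟙ℚ b) (sym (lift-q H j j′)))) ⟩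
        sumℚ i (λ j → sumℚ i (λ j′ → C (q j) (q j′) * χ (lift H) (q j) (q j′)))
          ≡⟨ sym (sumℚ-cong i (λ j → sumℚ-reindex _ (λ v v∉q → vanish (q j) v (v∉q ∘ proj₂)))) ⟩
        sumℚ i (λ j → sumℚ n (λ v → C (q j) v * χ (lift H) (q j) v))
          ≡⟨ sym (sumℚ-reindex _ (λ u u∉q → sumℚ-zero n (λ v → vanish u v (u∉q ∘ proj₁)))) ⟩
        sumℚ n (λ u → sumℚ n (λ v → C u v * χ (lift H) u v))
          ≡⟨ Φ-double (lift H) (lift-sym H) ⟩
        Φ (lift H) + Φ (lift H) ∎
        where
        open ≡-Reasoning
        vanish : ∀ u v → ¬ (InClique u × InClique v) → C u v * χ (lift H) u v ≡ 0ℚ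
        vanish u v outside = trans (cong (λ b → C u v * 𝟙ℚ b) (lift-outside H u v outside)) (ℚₚ.*-zeroʳ (C u v))

      Φ-withEdge : ∀ H t → ¬ (InClique (e₁ t) × InClique (e₂ t)) → Φ (withEdge H (e₁ t) (e₂ t)) ≡ c t + Φ (lift H)
      Φ-withEdge H t outside = begin
        Φ (withEdge H (e₁ t) (e₂ t))                                  ≡⟨ sumℚ-cong k term ⟩
        sumℚ k (λ t′ → singleℚ t (c t) t′ + c t′ * χ (lift H) (e₁ t′) (e₂ t′)) ≡⟨ sumℚ-distrib-+ k _ _ ⟩
        sumℚ k (singleℚ t (c t)) + Φ (lift H)                         ≡⟨ cong (_+ Φ (lift H)) (sumℚ-singleℚ k t (c t)) ⟩
        c t + Φ (lift H)                                              ∎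
        where
        open ≡-Reasoning
        term : ∀ t′ → c t′ * χ (withEdge H (e₁ t) (e₂ t)) (e₁ t′) (e₂ t′) ≡ singleℚ t (c t) t′ + c t′ * χ (lift H) (e₁ t′) (e₂ t′)
        term t′ with t′ ≟ t
        ... | yes refl rewrite lift-outside H (e₁ t′) (e₂ t′) outside | singleEdge-ends (e₁ t′) (e₂ t′) =
          trans (ℚₚ.*-identityʳ (c t′)) (sym (trans (cong (c t′ +_) (ℚₚ.*-zeroʳ (c t′))) (ℚₚ.+-identityʳ (c t′))))
        ... | no t′≢t rewrite singleEdge-other t t′ t′≢t | Boolₚ.∨-identityʳ (lift H (e₁ t′) (e₂ t′)) =
          sym (ℚₚ.+-identityˡ _)

upperℚ-zero : ∀ {n} (h : Fin n → Fin n → ℚ) j j′ → (toℕ j < toℕ j′ → h j j′ ≡ 0ℚ) → upperℚ h j j′ ≡ 0ℚ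
upperℚ-zero h j j′ h≡0 with toℕ j <ᵇ toℕ j′ in j<ᵇj′
... | true  = h≡0 (ℕₚ.<ᵇ⇒< (toℕ j) (toℕ j′) (Equivalence.from Boolₚ.T-≡ j<ᵇj′))
... | false = refl

cliqueLHS-linear : ∀ {n i N} (q : Fin i → Fin n) (λ′ : Fin N → ℚ) (X : Fin N → QVec n) →
                   cliqueLHS q (λ u v → sumℚ N (λ j → λ′ j * X j u v)) ≡ sumℚ N (λ j → λ′ j * cliqueLHS q (X j))
cliqueLHS-linear {n} {i} {N} q λ′ X = begin
  sumℚ i (λ r → sumℚ i (λ s → upperℚ (λ r s → sumℚ N (λ j → λ′ j * X j (q r) (q s))) r s))
    ≡⟨ sumℚ-cong i (λ r → sumℚ-cong i (λ s → pull-out r s)) ⟩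
  sumℚ i (λ r → sumℚ i (λ s → sumℚ N (λ j → λ′ j * upperℚ (Xq j) r s)))
    ≡⟨ trans (sumℚ-cong i (λ r → sumℚ-comm i N _)) (sumℚ-comm i N _) ⟩
  sumℚ N (λ j → sumℚ i (λ r → sumℚ i (λ s → λ′ j * upperℚ (Xq j) r s)))
    ≡⟨ sumℚ-cong N (λ j → trans (sumℚ-cong i (λ r → sym (*-distribˡ-sumℚ i (λ′ j) _))) (sym (*-distribˡ-sumℚ i (λ′ j) _))) ⟩
  sumℚ N (λ j → λ′ j * cliqueLHS q (X j)) ∎
  where
  open ≡-Reasoning
  Xq : Fin N → Fin i → Fin i → ℚ
  Xq j r s = X j (q r) (q s)
  pull-out : ∀ r s → upperℚ (λ r s → sumℚ N (λ j → λ′ j * X j (q r) (q s))) r s ≡ sumℚ N (λ j → λ′ j * upperℚ (Xq j) r s)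
  pull-out r s with toℕ r <ᵇ toℕ s
  ... | true  = refl
  ... | false = sym (sumℚ-zero N (λ j → ℚₚ.*-zeroʳ (λ′ j)))

cliqueLHS-concentrated : ∀ {n i} (q : Fin (suc (suc i)) → Fin n) (Y : QVec n) →
                         (∀ j j′ → toℕ j < toℕ j′ → j ≢ zero ⊎ j′ ≢ suc zero → Y (q j) (q j′) ≡ 0ℚ) →
                         cliqueLHS q Y ≡ Y (q zero) (q (suc zero))
cliqueLHS-concentrated {n} {i} q Y Y≡0 =
  trans (sumℚ-single (suc (suc i)) zero (λ j j≢0 → sumℚ-zero (suc (suc i)) (λ j′ → upperℚ-zero Yq j j′ (λ j<j′ → Y≡0 j j′ j<j′ (inj₁ j≢0)))))
        (sumℚ-single (suc (suc i)) (suc zero) (λ j′ j′≢1 → upperℚ-zero Yq zero j′ (λ 0<j′ → Y≡0 zero j′ 0<j′ (inj₂ j′≢1))))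
  where
  Yq : Fin (suc (suc i)) → Fin (suc (suc i)) → ℚ
  Yq j j′ = Y (q j) (q j′)

-- The polytope T(G,a,2) and the clique face

module Polytope {n : ℕ} (G : Graph n) (a : ℕ) (3≤a : 3 ≤ a) where
  open EdgeCoordinates G

  empty-inT : InT G a (λ _ _ → false)
  empty-inT = ((λ _ _ → refl) , (λ _ _ ())) , no-clique 3≤a
    where
    no-clique : ∀ {a} → 3 ≤ a → ¬ HasClique {n} a (λ _ _ → false)
    no-clique {suc zero}    (s≤s ())
    no-clique {suc (suc _)} _ (_ , _ , f-clique) = true≢false (sym (f-clique zero (suc zero) λ ()))

  singleEdge-inT : ∀ t → InT G a (singleEdge (e₁ t) (e₂ t))
  singleEdge-inT t =
    (singleEdge-sym (e₁ t) (e₂ t) , singleEdge⊆ G (e-adj t)) , singleEdge-cliqueFree 3≤a (e₁ t) (e₂ t) _ (λ _ _ uv → uv)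

  affInd-lower : HasAffInd (InT G a) (suc k)
  affInd-lower = Fs , inT , affInd
    where
    Fs : Fin (suc k) → EdgeRel n
    Fs zero    = λ _ _ → false
    Fs (suc t) = singleEdge (e₁ t) (e₂ t)
    inT : ∀ j → InT G a (Fs j)
    inT zero    = empty-inT
    inT (suc t) = singleEdge-inT t
    affInd : AffInd (χ ∘ Fs)
    affInd λ′ sum≡0 coords≡0 = λ′≡0
      where
      λ′suc≡0 : ∀ t → λ′ (suc t) ≡ 0ℚ
      λ′suc≡0 t = trans (sym coordinate-t) (coords≡0 (e₁ t) (e₂ t))
        where
        term : ∀ t′ → λ′ (suc t′) * χ (singleEdge (e₁ t′) (e₂ t′)) (e₁ t) (e₂ t) ≡ singleℚ t (λ′ (suc t)) t′
        term t′ with t′ ≟ t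
        ... | yes refl rewrite singleEdge-ends (e₁ t′) (e₂ t′) = ℚₚ.*-identityʳ _
        ... | no t′≢t  rewrite singleEdge-other t′ t (t′≢t ∘ sym) = ℚₚ.*-zeroʳ (λ′ (suc t′))
        coordinate-t : sumℚ (suc k) (λ j → λ′ j * χ (Fs j) (e₁ t) (e₂ t)) ≡ λ′ (suc t)
        coordinate-t = trans (cong₂ _+_ (ℚₚ.*-zeroʳ (λ′ zero)) (trans (sumℚ-cong k term) (sumℚ-singleℚ k t (λ′ (suc t)))))
                             (ℚₚ.+-identityˡ _)
      λ′≡0 : ∀ j → λ′ j ≡ 0ℚ
      λ′≡0 (suc t) = λ′suc≡0 t
      λ′≡0 zero    = trans (sym (ℚₚ.+-identityʳ (λ′ zero))) (trans (cong (λ′ zero +_) (sym (sumℚ-zero k λ′suc≡0))) sum≡0)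

  -- With k edge coordinates and the constant, k + 2 points always satisfy an affine relation.
  affInd-upper : ¬ HasAffInd (InT G a) (suc (suc k))
  affInd-upper (Fs , inT , affInd) with fewer-vectors-annihilated ℕₚ.≤-refl R
    where
    R : Fin (suc k) → Fin (suc (suc k)) → ℚ
    R zero    j = 1ℚ
    R (suc t) j = χ (Fs j) (e₁ t) (e₂ t)
  ... | λ′ , (j₀ , λ′j₀≢0) , λ′⊥R = λ′j₀≢0 (affInd λ′ sum≡0 coords≡0 j₀)
    where
    sum≡0 : sumℚ (suc (suc k)) λ′ ≡ 0ℚ
    sum≡0 = trans (sumℚ-cong (suc (suc k)) (λ j → sym (ℚₚ.*-identityʳ (λ′ j)))) (λ′⊥R zero)
    coords≡0 : ∀ u v → sumℚ (suc (suc k)) (λ j → λ′ j * χ (Fs j) u v) ≡ 0ℚ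
    coords≡0 = combination-vanishes Fs (proj₁ ∘ inT) λ′ (λ′⊥R ∘ suc)

  module CliqueInequality {i : ℕ} (q : Fin i → Fin n) (q-inj : Injective _≡_ _≡_ q) (m : ℕ)
                          (ex-bound : ∀ (H : Graph i) → CliqueFree a H → edgeCount H ≤ m) where
    open CliqueLift q q-inj

    valid : ∀ F → InT G a F → cliqueLHS q (χ F) ℚ.≤ fromℕℚ m
    valid F ((F-sym , F⊆G) , F-free) =
      subst (ℚ._≤ fromℕℚ m) (sym (cliqueLHS-χ F trace (λ _ _ → refl))) (fromℕℚ-mono-≤ (ex-bound trace trace-free))
      where
      irrefl : ∀ j → F (q j) (q j) ≡ false
      irrefl j with F (q j) (q j) in F-jj
      ... | false = refl
      ... | true  = ⊥-elim (true≢false (trans (sym (F⊆G (q j) (q j) F-jj)) (adj-irrefl G (q j))))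
      trace : Graph i
      trace = record { adj = λ j j′ → F (q j) (q j′) ; adj-sym = λ j j′ → F-sym (q j) (q j′) ; adj-irrefl = irrefl }
      trace-free : CliqueFree a trace
      trace-free (g , g-inj , g-clique) = F-free (q ∘ g , g-inj ∘ q-inj , g-clique)

    Face : EdgeRel n → Set
    Face F = InT G a F × cliqueLHS q (χ F) ≡ fromℕℚ m

  module CliqueFace {i′ : ℕ} (q : Fin (suc (suc i′)) → Fin n) (q-inj : Injective _≡_ _≡_ q)
                    (q-clique : ∀ j j′ → j ≢ j′ → adj G (q j) (q j′) ≡ true) (m : ℕ)
                    (ex-bound : ∀ (H : Graph (suc (suc i′))) → CliqueFree a H → edgeCount H ≤ m) where
    open CliqueLift q q-inj
    open CliqueInequality q q-inj m ex-bound

    t₀ : Fin k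
    t₀ = proj₁ (edge-joining (q zero) (q (suc zero)) (q-clique zero (suc zero) λ ()))

    t₀-joins : Joins t₀ (q zero) (q (suc zero))
    t₀-joins = proj₂ (edge-joining (q zero) (q (suc zero)) (q-clique zero (suc zero) λ ()))

    t₀-joins-only : ∀ j j′ → toℕ j < toℕ j′ → Joins t₀ (q j) (q j′) → j ≡ zero × j′ ≡ suc zero
    t₀-joins-only j j′ j<j′ joins with joins | t₀-joins
    ... | inj₁ (e₁≡qj , e₂≡qj′) | inj₁ (e₁≡q0 , e₂≡q1) = q-inj (trans (sym e₁≡qj) e₁≡q0) , q-inj (trans (sym e₂≡qj′) e₂≡q1)
    ... | inj₂ (e₁≡qj′ , e₂≡qj) | inj₂ (e₁≡q1 , e₂≡q0) = q-inj (trans (sym e₂≡qj) e₂≡q0) , q-inj (trans (sym e₁≡qj′) e₁≡q1)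
    ... | inj₁ (e₁≡qj , e₂≡qj′) | inj₂ (e₁≡q1 , e₂≡q0) =
      ⊥-elim (ℕₚ.<-asym j<j′ (subst₂ (λ r s → toℕ r < toℕ s) (q-inj (trans (sym e₂≡q0) e₂≡qj′)) (q-inj (trans (sym e₁≡q1) e₁≡qj)) (s≤s z≤n)))
    ... | inj₂ (e₁≡qj′ , e₂≡qj) | inj₁ (e₁≡q0 , e₂≡q1) =
      ⊥-elim (ℕₚ.<-asym j<j′ (subst₂ (λ r s → toℕ r < toℕ s) (q-inj (trans (sym e₁≡q0) e₁≡qj′)) (q-inj (trans (sym e₂≡q1) e₂≡qj)) (s≤s z≤n)))

    -- The face lies in the hyperplane cliqueLHS = m, so the coordinate t₀ may be traded for the constant row.
    face-upper : ¬ HasAffInd Face (suc k)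
    face-upper (Fs , inFace , affInd) with fewer-vectors-annihilated ℕₚ.≤-refl R
      where
      R : Fin k → Fin (suc k) → ℚ
      R t j = if does (t ≟ t₀) then 1ℚ else χ (Fs j) (e₁ t) (e₂ t)
    ... | λ′ , (j₀ , λ′j₀≢0) , λ′⊥R = λ′j₀≢0 (affInd λ′ sum≡0 (combination-vanishes Fs Fs⊆G λ′ Y-edge) j₀)
      where
      Fs⊆G : ∀ j → EdgeSubset G (Fs j)
      Fs⊆G j = proj₁ (proj₁ (inFace j))
      Y : Fin n → Fin n → ℚ
      Y u v = sumℚ (suc k) (λ j → λ′ j * χ (Fs j) u v)
      sum≡0 : sumℚ (suc k) λ′ ≡ 0ℚ
      sum≡0 = trans (sumℚ-cong (suc k) (λ j → trans (sym (ℚₚ.*-identityʳ (λ′ j)))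
                       (cong (λ b → λ′ j * (if b then 1ℚ else χ (Fs j) (e₁ t₀) (e₂ t₀))) (sym (dec-true (t₀ ≟ t₀) refl)))))
                    (λ′⊥R t₀)
      Y-other-edge : ∀ t → t ≢ t₀ → Y (e₁ t) (e₂ t) ≡ 0ℚ
      Y-other-edge t t≢t₀ = trans (sumℚ-cong (suc k) (λ j → cong (λ b → λ′ j * (if b then 1ℚ else χ (Fs j) (e₁ t) (e₂ t)))
                                                                   (sym (dec-false (t ≟ t₀) t≢t₀))))
                                  (λ′⊥R t)
      Y-clique≡0 : cliqueLHS q Y ≡ 0ℚ
      Y-clique≡0 = begin
        cliqueLHS q Y                                        ≡⟨ cliqueLHS-linear q λ′ (χ ∘ Fs) ⟩
        sumℚ (suc k) (λ j → λ′ j * cliqueLHS q (χ (Fs j)))   ≡⟨ sumℚ-cong (suc k) (λ j → cong (λ′ j *_) (proj₂ (inFace j))) ⟩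
        sumℚ (suc k) (λ j → λ′ j * fromℕℚ m)                 ≡⟨ sym (*-distribʳ-sumℚ (suc k) (fromℕℚ m) λ′) ⟩
        sumℚ (suc k) λ′ * fromℕℚ m                           ≡⟨ cong (_* fromℕℚ m) sum≡0 ⟩
        0ℚ * fromℕℚ m                                        ≡⟨ ℚₚ.*-zeroˡ (fromℕℚ m) ⟩
        0ℚ                                                   ∎
        where open ≡-Reasoning
      Y-clique-pair : ∀ j j′ → toℕ j < toℕ j′ → j ≢ zero ⊎ j′ ≢ suc zero → Y (q j) (q j′) ≡ 0ℚ
      Y-clique-pair j j′ j<j′ not-01 = combination-vanishes-at Fs Fs⊆G λ′ (q j) (q j′) λ t joins →
        Y-other-edge t λ { refl → not-01-pair not-01 (t₀-joins-only j j′ j<j′ joins) }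
        where
        not-01-pair : j ≢ zero ⊎ j′ ≢ suc zero → ¬ (j ≡ zero × j′ ≡ suc zero)
        not-01-pair (inj₁ j≢0)  (j≡0 , _)  = j≢0 j≡0
        not-01-pair (inj₂ j′≢1) (_ , j′≡1) = j′≢1 j′≡1
      Y-q₀q₁≡0 : Y (q zero) (q (suc zero)) ≡ 0ℚ
      Y-q₀q₁≡0 = trans (sym (cliqueLHS-concentrated q Y Y-clique-pair)) Y-clique≡0
      Y-edge : ∀ t → Y (e₁ t) (e₂ t) ≡ 0ℚ
      Y-edge t with t ≟ t₀
      ... | no t≢t₀ = Y-other-edge t t≢t₀
      ... | yes refl with t₀-joins
      ...   | inj₁ (e₁≡q₀ , e₂≡q₁) = trans (cong₂ Y e₁≡q₀ e₂≡q₁) Y-q₀q₁≡0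
      ...   | inj₂ (e₁≡q₁ , e₂≡q₀) = trans (cong₂ Y e₁≡q₁ e₂≡q₀)
                                       (trans (sumℚ-cong (suc k) (λ j → cong (λ′ j *_) (χ-sym (Fs j) (proj₁ (Fs⊆G j)) (q (suc zero)) (q zero)))) Y-q₀q₁≡0)

quadruple-codes : ∀ k I → Fin (k ℕ.+ I ℕ.* (I ℕ.* (I ℕ.* 4))) ↔ (Fin k ⊎ (Fin I × Fin I × Fin I × Fin 4))
quadruple-codes k I = (↔-id _ ⊎-↔ ((↔-id _ ×-↔ (↔-id _ ×-↔ Finₚ.*↔×)) ↔-∘ ((↔-id _ ×-↔ Finₚ.*↔×) ↔-∘ Finₚ.*↔×))) ↔-∘ Finₚ.+↔⊎

module FaceLowerBound {n i′ : ℕ} (G : Graph n) (a : ℕ) (3≤a : 3 ≤ a) (a≤I : a ≤ suc (suc i′)) (∤I : ¬ (a ∸ 1) ∣ suc (suc i′))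
                      (q : Fin (suc (suc i′)) → Fin n) (q-inj : Injective _≡_ _≡_ q)
                      (q-clique : ∀ j j′ → j ≢ j′ → adj G (q j) (q j′) ≡ true) (m : ℕ)
                      (ex-bound : ∀ (H : Graph (suc (suc i′))) → CliqueFree a H → edgeCount H ≤ m)
                      {H₀ : Graph (suc (suc i′))} (H₀-free : CliqueFree a H₀) (H₀-size : edgeCount H₀ ≡ m) where

  I : ℕ
  I = suc (suc i′)

  open EdgeCoordinates G
  open Polytope G a 3≤a
  open CliqueLift q q-inj
  open CliqueInequality q q-inj m ex-bound
  open ExtremalGraphs a m ex-bound

  ext₀ : Extremal H₀
  ext₀ = extremal H₀-free (trans (handshake H₀) (cong (λ e → e ℕ.+ e) H₀-size))

  open ExchangeConstruction a m ex-bound ext₀ (ExtremalStructure.unbalancedTriple a m ex-bound ext₀ 3≤a a≤I ∤I)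

  extremal-face : ∀ F H → Extremal H → EdgeSubset G F → ¬ HasClique a F → (∀ j j′ → F (q j) (q j′) ≡ adj H j j′) → Face F
  extremal-face F H (extremal _ sum≡) F⊆G F-free F≡H =
    (F⊆G , F-free) , trans (cliqueLHS-χ F H F≡H) (cong fromℕℚ (double-injective {edgeCount H} {m} (trans (sym (handshake H)) sum≡)))

  lift-face : ∀ H → Extremal H → Face (lift H)
  lift-face H ext = extremal-face (lift H) H ext (lift-edgeSubset G q-clique H)
                                  (lift-cliqueFree H (ℕₚ.≤-trans (s≤s (s≤s z≤n)) 3≤a) (Extremal.cliqueFree ext)) (lift-q H)

  Distinct : Fin I → Fin I → Fin I → Set
  Distinct x y z = x ≢ y × x ≢ z × y ≢ z

  distinct? : ∀ x y z → Dec (Distinct x y z)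
  distinct? x y z = ¬? (x ≟ y) ×-dec ¬? (x ≟ z) ×-dec ¬? (y ≟ z)

  exchangeGraph : Fin I → Fin I → Fin I → Fin 4 → Graph I
  exchangeGraph x y z r = if does (distinct? x y z) then ExchangeGraphs.graph x y z r else H₀

  exchangeGraph-extremal : ∀ x y z r → Extremal (exchangeGraph x y z r)
  exchangeGraph-extremal x y z r = by-cases (distinct? x y z)
    where
    by-cases : (d : Dec (Distinct x y z)) → Extremal (if does d then ExchangeGraphs.graph x y z r else H₀)
    by-cases (yes (x≢y , x≢z , y≢z)) = exchange-extremal x≢y x≢z y≢z r
    by-cases (no _)                  = ext₀

  exchangeGraph-distinct : ∀ {x y z} (x≢y : x ≢ y) (x≢z : x ≢ z) (y≢z : y ≢ z) r →
                           exchangeGraph x y z r ≡ Exchange.graph (exchange x≢y x≢z y≢z) r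
  exchangeGraph-distinct {x} {y} {z} x≢y x≢z y≢z r =
    trans (cong (λ b → if b then ExchangeGraphs.graph x y z r else H₀) (dec-true (distinct? x y z) (x≢y , x≢z , y≢z)))
          (sym (exchange-graph x≢y x≢z y≢z r))

  exchangeGraph-degenerate : ∀ x → exchangeGraph x x x zero ≡ H₀
  exchangeGraph-degenerate x =
    cong (λ b → if b then ExchangeGraphs.graph x x x zero else H₀) (dec-false (distinct? x x x) (λ (x≢x , _) → x≢x refl))

  Code : Set
  Code = Fin k ⊎ (Fin I × Fin I × Fin I × Fin 4)

  codes : Fin (k ℕ.+ I ℕ.* (I ℕ.* (I ℕ.* 4))) ↔ Code
  codes = quadruple-codes k I

  -- Edges inside the clique are handled by the exchange graphs, edges leaving it by adding them to the lift of H₀.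
  member : Code → EdgeRel n
  member (inj₁ t) with inClique? (e₁ t) ×-dec inClique? (e₂ t)
  ... | yes _ = lift H₀
  ... | no _  = withEdge H₀ (e₁ t) (e₂ t)
  member (inj₂ (x , y , z , r)) = lift (exchangeGraph x y z r)

  withEdge-face : ∀ t → (outside : ¬ (InClique (e₁ t) × InClique (e₂ t))) → Face (withEdge H₀ (e₁ t) (e₂ t))
  withEdge-face t outside = extremal-face _ H₀ ext₀ (withEdge-edgeSubset G q-clique H₀ (e-adj t))
    (withEdge-cliqueFree outside H₀ 3≤a H₀-free) (withEdge-q outside H₀)

  member-face : ∀ code → Face (member code)
  member-face (inj₁ t) with inClique? (e₁ t) ×-dec inClique? (e₂ t)
  ... | yes _       = lift-face H₀ ext₀
  ... | no outside  = withEdge-face t outside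
  member-face (inj₂ (x , y , z , r)) = lift-face (exchangeGraph x y z r) (exchangeGraph-extremal x y z r)

  module _ (c : Fin k → ℚ) (Φ≡0 : ∀ code → Coefficients.Φ c (member code) ≡ 0ℚ) where
    open Coefficients c

    Φ-lift-H₀ : Φ (lift H₀) ≡ 0ℚ
    Φ-lift-H₀ = subst (λ H → Φ (lift H) ≡ 0ℚ) (exchangeGraph-degenerate zero) (Φ≡0 (inj₂ (zero , zero , zero , zero)))

    outside-coefficient : ∀ t → ¬ (InClique (e₁ t) × InClique (e₂ t)) → c t ≡ 0ℚ
    outside-coefficient t outside = begin
      c t                                ≡⟨ sym (ℚₚ.+-identityʳ (c t)) ⟩
      c t + 0ℚ                           ≡⟨ cong (c t +_) (sym Φ-lift-H₀) ⟩
      c t + Φ (lift H₀)                  ≡⟨ sym (Φ-withEdge G q-clique c H₀ t outside) ⟩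
      Φ (withEdge H₀ (e₁ t) (e₂ t))      ≡⟨ cong Φ (sym member-t) ⟩
      Φ (member (inj₁ t))                ≡⟨ Φ≡0 (inj₁ t) ⟩
      0ℚ                                 ∎
      where
      open ≡-Reasoning
      member-t : member (inj₁ t) ≡ withEdge H₀ (e₁ t) (e₂ t)
      member-t with inClique? (e₁ t) ×-dec inClique? (e₂ t)
      ... | yes inside = ⊥-elim (outside inside)
      ... | no _       = refl

    inside-coefficient : ∀ t {j j′} → q j ≡ e₁ t → q j′ ≡ e₂ t → c t ≡ 0ℚ
    inside-coefficient t {j} {j′} qj≡e₁ qj′≡e₂ = begin
      c t                    ≡⟨ sym (C-edge t) ⟩
      C (e₁ t) (e₂ t)        ≡⟨ sym (cong₂ C qj≡e₁ qj′≡e₂) ⟩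
      f G q-clique c j j′    ≡⟨ weights-vanish (f G q-clique c) (f-sym G q-clique c) Ψ-exchange≡0 ΨH₀≡0 j j′ j≢j′ ⟩
      0ℚ                     ∎
      where
      open ≡-Reasoning
      open Weight (f G q-clique c) (f-sym G q-clique c)
      j≢j′ : j ≢ j′
      j≢j′ refl = e₁≢e₂ t (trans (sym qj≡e₁) qj′≡e₂)
      Ψ≡0 : ∀ H → Φ (lift H) ≡ 0ℚ → Ψ H ≡ 0ℚ
      Ψ≡0 H Φ≡0′ = trans (Ψ-lift G q-clique c H) (trans (cong₂ _+_ Φ≡0′ Φ≡0′) (ℚₚ.+-identityʳ 0ℚ))
      Ψ-exchange≡0 : ∀ {x y z} (x≢y : x ≢ y) (x≢z : x ≢ z) (y≢z : y ≢ z) r → Ψ (Exchange.graph (exchange x≢y x≢z y≢z) r) ≡ 0ℚ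
      Ψ-exchange≡0 {x} {y} {z} x≢y x≢z y≢z r =
        Ψ≡0 _ (subst (λ H → Φ (lift H) ≡ 0ℚ) (exchangeGraph-distinct x≢y x≢z y≢z r) (Φ≡0 (inj₂ (x , y , z , r))))
      ΨH₀≡0 : Ψ H₀ ≡ 0ℚ
      ΨH₀≡0 = Ψ≡0 H₀ Φ-lift-H₀

    annihilator-trivial : ∀ t → c t ≡ 0ℚ
    annihilator-trivial t with inClique? (e₁ t) ×-dec inClique? (e₂ t)
    ... | yes ((j , qj≡e₁) , (j′ , qj′≡e₂)) = inside-coefficient t qj≡e₁ qj′≡e₂
    ... | no outside                        = outside-coefficient t outside

  face-lower : HasAffInd Face k
  face-lower with independent-or-annihilated k _ W
    where
    W : Fin (k ℕ.+ I ℕ.* (I ℕ.* (I ℕ.* 4))) → Fin k → ℚ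
    W j t = χ (member (Inverse.to codes j)) (e₁ t) (e₂ t)
  ... | inj₁ (s , independent) =
    member ∘ Inverse.to codes ∘ s , member-face ∘ Inverse.to codes ∘ s , λ λ′ _ coords≡0 → independent λ′ (λ t → coords≡0 (e₁ t) (e₂ t))
  ... | inj₂ (c , (t , ct≢0) , c⊥W) = ⊥-elim (ct≢0 (annihilator-trivial c Φ≡0 t))
    where
    Φ≡0 : ∀ code → Coefficients.Φ c (member code) ≡ 0ℚ
    Φ≡0 code = subst (λ code′ → Coefficients.Φ c (member code′) ≡ 0ℚ) (Inverse.strictlyInverseˡ codes code) (c⊥W (Inverse.from codes code))

complete-clique : ∀ {n i} (q : Fin i → Fin n) → Injective _≡_ _≡_ q → ∀ j k → j ≢ k → adj (complete n) (q j) (q k) ≡ true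
complete-clique q q-inj j k j≢k with q j ≟ q k
... | yes qj≡qk = ⊥-elim (j≢k (q-inj qj≡qk))
... | no _      = refl

clique-facet : ∀ {n} (G : Graph n) (a i : ℕ) (q : Fin i → Fin n) →
               3 ≤ a → a ≤ i → ¬ ((a ∸ 1) ∣ i) →
               Injective _≡_ _≡_ q → (∀ j k → j ≢ k → adj G (q j) (q k) ≡ true) →
               ∀ (m : ℕ) → IsEx i a m →
               FacetDefining (InT G a) (cliqueLHS q) (fromℕℚ m)
clique-facet G a (suc (suc i′)) q 3≤a a≤i ∤i q-inj q-clique m ((H₀ , H₀-free , H₀-size) , ex-bound) =
  valid , k , (affInd-lower , affInd-upper) , (face-lower , face-upper)
  where
  open EdgeCoordinates G
  open Polytope G a 3≤a
  open CliqueInequality q q-inj m ex-bound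
  open CliqueFace q q-inj q-clique m ex-bound
  open FaceLowerBound G a 3≤a a≤i ∤i q q-inj q-clique m ex-bound {H₀} H₀-free H₀-size
clique-facet G (suc (suc (suc a))) zero          q (s≤s (s≤s (s≤s _))) () _ _ _ _ _
clique-facet G (suc (suc (suc a))) (suc zero)    q (s≤s (s≤s (s≤s _))) (s≤s ()) _ _ _ _ _

mainTheorem8 : ∀ {n} (G : Graph n) (a i : ℕ) (q : Fin i → Fin n) →
    3 ≤ a → a ≤ i → ¬ ((a ∸ 1) ∣ i) →
    Injective _≡_ _≡_ q → (∀ j k → j ≢ k → adj G (q j) (q k) ≡ true) →
    ∀ (m : ℕ) → IsEx i a m →
    FacetDefining (InT G a) (cliqueLHS q) (fromℕℚ m) ×
    (∀ (n' : ℕ) → i ≤ n' → (q' : Fin i → Fin n') → Injective _≡_ _≡_ q' →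
      FacetDefining (InT (complete n') a) (cliqueLHS q') (fromℕℚ m))
-- The hypothesis i ≤ n′ is implied by the injectivity of q′.
mainTheorem8 G a i q 3≤a a≤i ∤i q-inj q-clique m isEx =
  clique-facet G a i q 3≤a a≤i ∤i q-inj q-clique m isEx ,
  λ n′ _ q′ q′-inj → clique-facet (complete n′) a i q′ 3≤a a≤i ∤i q′-inj (complete-clique q′ q′-inj) m isEx
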